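{- Let $A$ be a $PT$-matrix of type 2(c). Then $A$ has finite multiplicative order if and only if $A$ or its transpose is permutation similar to the matrix $(C_p\oplus C_q)+T(1,n,h+1,n-l)$, where $n=p+q$, $1\le h<p$, $1\le l<q$, and $\gcd(p,q)$ divides at least one of $h$ and $l$. When this occurs, the multiplicative order of $A$ is $\mathrm{lcm}(p,q)$.
   Context: $C_k$ is the $k\times k$ permutation matrix with $1$ in positions $(i+1,i)$ for $1\le i\le k-1$ and in position $(1,k)$ (companion matrix of $x^k-1$); $\oplus$ is the matrix direct sum. A $T$-block $T(i_1,j_1,i_2,j_2)$ (with $i_1\ne i_2$, $j_1\ne j_2$) is the $n\times n$ matrix with $1$ in positions $(i_1,j_1),(i_2,j_2)$, $-1$ in positions $(i_1,j_2),(i_2,j_1)$, $0$ elsewhere. A $PT$-matrix is $P+T$ with $P$ a permutation matrix and $T$ a $T$-block. Its digraph has vertices $w_1,\dots,w_n$, a blue arc $(w_i,w_j)$ when the $(i,j)$ entry is $1$ and a red arc when it is $-1$. A $PT$-matrix $P+T$ is of type 2(c) if the non-zero positions of $T$ are disjoint from the $1$'s of $P$, the permutation $P$ has exactly two cycles, and, writing the red arcs as $(u_1,v_1),(u_2,v_2)$, the vertices $u_1,u_2$ lie in one cycle of $P$ and $v_1,v_2$ in the other. Matrices $A,B$ are permutation similar if $B=R^TAR$ for a permutation matrix $R$. -}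

module Defs where

open import Data.Nat as ℕ using (ℕ; zero; suc; _+_; _≤_; _<_)
open import Data.Integer as ℤ using (ℤ; 0ℤ; 1ℤ; -1ℤ)
open import Data.Fin using (Fin; toℕ; splitAt)
open import Data.Fin.Permutation using (Permutation′; _⟨$⟩ʳ_)
open import Data.Sum using (_⊎_; inj₁; inj₂)
open import Data.Product using (Σ; ∃; _×_; _,_)
open import Relation.Binary.PropositionalEquality using (_≡_)
open import Relation.Nullary using (¬_; Dec; yes; no)
open import Relation.Nullary.Decidable using (⌊_⌋; _×-dec_)
open import Data.Bool using (Bool; true; false; if_then_else_; _∨_)

Matrix : ℕ → Set
Matrix n = Fin n → Fin n → ℤ

_≋_ : ∀ {n} → Matrix n → Matrix n → Set
A ≋ B = ∀ i j → A i j ≡ B i j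

sumFin : ∀ n → (Fin n → ℤ) → ℤ
sumFin zero f = 0ℤ
sumFin (suc n) f = f Fin.zero ℤ.+ sumFin n (λ i → f (Fin.suc i))
  where import Data.Fin as Fin

_⊕ₘ_ : ∀ {n} → Matrix n → Matrix n → Matrix n
(A ⊕ₘ B) i j = A i j ℤ.+ B i j

_⊗_ : ∀ {n} → Matrix n → Matrix n → Matrix n
_⊗_ {n} A B i j = sumFin n (λ k → A i k ℤ.* B k j)

transpose : ∀ {n} → Matrix n → Matrix n
transpose A i j = A j i

ind : Bool → ℤ
ind b = if b then 1ℤ else 0ℤ

identity : ∀ {n} → Matrix n
identity i j = ind ⌊ i Data.Fin.≟ j ⌋
  where import Data.Fin

_^ₘ_ : ∀ {n} → Matrix n → ℕ → Matrix n
A ^ₘ zero = identity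
A ^ₘ suc k = A ⊗ (A ^ₘ k)

permMat : ∀ {n} → Permutation′ n → Matrix n
permMat σ i j = ind ⌊ i Data.Fin.≟ (σ ⟨$⟩ʳ j) ⌋
  where import Data.Fin

PermSimilar : ∀ {n} → Matrix n → Matrix n → Set
PermSimilar A B = ∃ λ (ρ : Permutation′ _) →
  B ≋ ((transpose (permMat ρ) ⊗ A) ⊗ permMat ρ)

HasFiniteOrder : ∀ {n} → Matrix n → Set
HasFiniteOrder A = ∃ λ k → 1 ≤ k × (A ^ₘ k) ≋ identity

MultOrder : ∀ {n} → Matrix n → ℕ → Set
MultOrder A k = 1 ≤ k × (A ^ₘ k) ≋ identity
  × (∀ m → 1 ≤ m → (A ^ₘ m) ≋ identity → k ≤ m)

-- T-block T(i1,j1,i2,j2) with 1-based natural-number indices (as in the paper):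
-- 1 at (i1,j1),(i2,j2), -1 at (i1,j2),(i2,j1), 0 elsewhere
Tblock : ∀ n → ℕ → ℕ → ℕ → ℕ → Matrix n
Tblock n i1 j1 i2 j2 r c =
  ind (at i1 j1) ℤ.+ ind (at i2 j2) ℤ.- ind (at i1 j2) ℤ.- ind (at i2 j1)
  where
  at : ℕ → ℕ → Bool
  at a b = ⌊ (suc (toℕ r) ℕ.≟ a) ×-dec (suc (toℕ c) ℕ.≟ b) ⌋

-- the k×k companion matrix C_k of x^k - 1:
-- 1 at (i+1,i) for 1 ≤ i ≤ k-1 and at (1,k) (1-based)
C : ∀ k → Matrix k
C k r c = ind (⌊ suc (toℕ r) ℕ.≟ suc (suc (toℕ c)) ⌋
             ∨ ⌊ (suc (toℕ r) ℕ.≟ 1) ×-dec (suc (toℕ c) ℕ.≟ k) ⌋)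

_⊞_ : ∀ {p q} → Matrix p → Matrix q → Matrix (p + q)
_⊞_ {p} {q} M N r c with splitAt p r | splitAt p c
... | inj₁ r′ | inj₁ c′ = M r′ c′
... | inj₂ r′ | inj₂ c′ = N r′ c′
... | _ | _ = 0ℤ

_^ₚ_ : ∀ {n} → Permutation′ n → ℕ → Fin n → Fin n
(σ ^ₚ zero) x = x
(σ ^ₚ suc k) x = σ ⟨$⟩ʳ ((σ ^ₚ k) x)

SameCycle : ∀ {n} → Permutation′ n → Fin n → Fin n → Set
SameCycle σ a b = ∃ λ k → (σ ^ₚ k) a ≡ b

TwoCycles : ∀ {n} → Permutation′ n → Set
TwoCycles σ = ∃ λ a → ∃ λ b → ¬ SameCycle σ a b
  × (∀ x → SameCycle σ a x ⊎ SameCycle σ b x)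

idx : ∀ {n} → Fin n → ℕ
idx i = suc (toℕ i)

-- P_σ + T(i1,j1,i2,j2) (i1,j1,i2,j2 given as vertices / 0-based Fin) is a PT-matrix of type 2(c)
Type2c : ∀ {n} → Permutation′ n → Fin n → Fin n → Fin n → Fin n → Set
Type2c σ i1 j1 i2 j2 =
  ¬ i1 ≡ i2 × ¬ j1 ≡ j2
  -- non-zero positions of T are disjoint from the 1's of P
  × ¬ i1 ≡ σ ⟨$⟩ʳ j1 × ¬ i2 ≡ σ ⟨$⟩ʳ j2 × ¬ i1 ≡ σ ⟨$⟩ʳ j2 × ¬ i2 ≡ σ ⟨$⟩ʳ j1
  × TwoCycles σ
  -- red arcs (i1,j2),(i2,j1): tails in one cycle, heads in the other
  × SameCycle σ i1 i2 × SameCycle σ j2 j1 × ¬ SameCycle σ i1 j2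

PTmatrix : ∀ {n} → Permutation′ n → Fin n → Fin n → Fin n → Fin n → Matrix n
PTmatrix {n} σ i1 j1 i2 j2 = permMat σ ⊕ₘ Tblock n (idx i1) (idx j1) (idx i2) (idx j2)

target : ∀ p q → ℕ → ℕ → Matrix (p + q)
target p q h l = (C p ⊞ C q) ⊕ₘ Tblock (p + q) 1 (p + q) (suc h) ((p + q) ℕ.∸ l)

{-# OPTIONS --safe #-}
module Submission where

-- Write A = P_σ + (e_{i₁} - e_{i₂})(e_{j₁} - e_{j₂})ᵀ. As the tails i₁, i₂ and the heads j₁, j₂ lie in
-- different cycles of σ, the rank-one part never acts on its own image and
--   (Aᵏ)_{rc} = [r = σᵏ c] + Σ_{a<k} α_a(r) γ_a(σᵏ c),
-- with α_a = e_{σᵃ i₁} - e_{σᵃ i₂} and γ_a = e_{σᵃ⁺¹ j₁} - e_{σᵃ⁺¹ j₂}.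
-- Listing the cycle of i₁ from i₁ and the cycle of j₁ from σ j₁ relabels A as (C_p ⊕ C_q) + T(1, n, h+1, n-l),
-- where p, q are the cycle lengths, σʰ i₁ = i₂ and σˡ j₂ = j₁. For this normal form the diagonal of Aᵏ
-- is that of P_σᵏ, so Aᵏ = I forces lcm(p, q) ∣ k; and the entry (1, p+1) of Aᵏ is
--   Σ_{a<k} ([p ∣ a] - [p ∣ h + a]) ([q ∣ a] - [q ∣ q - l + a]),
-- whose first term is 1 and whose terms are all ≥ 0 unless gcd(p, q) divides h or l. Conversely, when
-- gcd(p, q) divides h (or l), shifting the summation index by a common solution t of two congruences
-- modulo p and q pairs up the four sums into which each cross sum of A^lcm(p,q) splits, so they cancel.

open import Defs
import Data.Nat as ℕ
import Data.Nat.Properties as ℕₚ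
open import Data.Integer using (ℤ; 0ℤ; 1ℤ)
import Data.Integer.Properties as ℤₚ
open import Data.Empty using (⊥; ⊥-elim)
open import Data.Fin as Fin using (Fin; toℕ; fromℕ<; _↑ˡ_; _↑ʳ_; splitAt; join)
import Data.Fin.Properties as Finₚ
open import Data.Fin.Permutation using (Permutation; Permutation′; permutation; _⟨$⟩ʳ_; _⟨$⟩ˡ_; inverseʳ; ↔⇒≡)
open import Data.Product using (Σ; ∃; ∃₂; _×_; _,_; proj₁; proj₂)
open import Data.Sum as Sum using (_⊎_; inj₁; inj₂)
open import Relation.Nullary using (¬_; Dec; yes; no)
open import Relation.Nullary.Decidable using (⌊_⌋)
open import Relation.Binary.PropositionalEquality
open import Function.Base using (_∘_)
open import Function.Bundles using (Injection; _⇔_; mk⇔; Equivalence)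
open import Function.Properties.Inverse using (↔⇒↣)

open ℕ using (ℕ; zero; suc)

⟨$⟩ʳ-injective : ∀ {m n} (π : Permutation m n) {x y} → π ⟨$⟩ʳ x ≡ π ⟨$⟩ʳ y → x ≡ y
⟨$⟩ʳ-injective π = Injection.injective (↔⇒↣ π)

module Kronecker where

  open import Data.Integer using (_≤_; _-_; _*_; +≤+)

  ind-cong : ∀ {a b} {P : Set a} {Q : Set b} (p? : Dec P) (q? : Dec Q) → (P → Q) → (Q → P) →
             ind ⌊ p? ⌋ ≡ ind ⌊ q? ⌋
  ind-cong (yes p) (yes q) f g = refl
  ind-cong (yes p) (no ¬q) f g = ⊥-elim (¬q (f p))
  ind-cong (no ¬p) (yes q) f g = ⊥-elim (¬p (g q))
  ind-cong (no ¬p) (no ¬q) f g = refl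

  ind-yes : ∀ {a} {P : Set a} (p? : Dec P) → P → ind ⌊ p? ⌋ ≡ 1ℤ
  ind-yes (yes _) _ = refl
  ind-yes (no ¬p) p = ⊥-elim (¬p p)

  ind-no : ∀ {a} {P : Set a} (p? : Dec P) → ¬ P → ind ⌊ p? ⌋ ≡ 0ℤ
  ind-no (yes p) ¬p = ⊥-elim (¬p p)
  ind-no (no _) _ = refl

  δ : ∀ {n} → Fin n → Fin n → ℤ
  δ i j = ind ⌊ i Fin.≟ j ⌋

  δ-≡ : ∀ {n} {i j : Fin n} → i ≡ j → δ i j ≡ 1ℤ
  δ-≡ {i = i} {j} = ind-yes (i Fin.≟ j)

  δ-≢ : ∀ {n} {i j : Fin n} → ¬ i ≡ j → δ i j ≡ 0ℤ
  δ-≢ {i = i} {j} = ind-no (i Fin.≟ j)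

  δ-refl : ∀ {n} (i : Fin n) → δ i i ≡ 1ℤ
  δ-refl i = δ-≡ refl

  δ≡1⇒≡ : ∀ {n} {i j : Fin n} → δ i j ≡ 1ℤ → i ≡ j
  δ≡1⇒≡ {i = i} {j} δ≡1 with i Fin.≟ j | δ≡1
  ... | yes i≡j | _ = i≡j
  ... | no _ | ()

  δ-sym : ∀ {n} (i j : Fin n) → δ i j ≡ δ j i
  δ-sym i j = ind-cong (i Fin.≟ j) (j Fin.≟ i) sym sym

  δ-injective : ∀ {m n} (f : Fin m → Fin n) → (∀ {x y} → f x ≡ f y → x ≡ y) →
                ∀ i j → δ (f i) (f j) ≡ δ i j
  δ-injective f f-inj i j = ind-cong (f i Fin.≟ f j) (i Fin.≟ j) f-inj (cong f)

  ind-sign : ∀ {a b c d} {A : Set a} {B : Set b} {C : Set c} {D : Set d}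
    (a? : Dec A) (b? : Dec B) (c? : Dec C) (d? : Dec D) → (A → D → ⊥) → (B → C → ⊥) →
    0ℤ ≤ (ind ⌊ a? ⌋ - ind ⌊ b? ⌋) * (ind ⌊ c? ⌋ - ind ⌊ d? ⌋)
  ind-sign (yes a) _ _ (yes d) ¬a∧d _ = ⊥-elim (¬a∧d a d)
  ind-sign _ (yes b) (yes c) _ _ ¬b∧c = ⊥-elim (¬b∧c b c)
  ind-sign (no _) (no _) _ _ _ _ = +≤+ ℕ.z≤n
  ind-sign (yes _) (yes _) _ _ _ _ = +≤+ ℕ.z≤n
  ind-sign (yes _) (no _) (yes _) (no _) _ _ = +≤+ ℕ.z≤n
  ind-sign (yes _) (no _) (no _) (no _) _ _ = +≤+ ℕ.z≤n
  ind-sign (no _) (yes _) (no _) (yes _) _ _ = +≤+ ℕ.z≤n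
  ind-sign (no _) (yes _) (no _) (no _) _ _ = +≤+ ℕ.z≤n

module Summation where

  open Kronecker
  open import Data.Integer using (_+_; _*_; _-_; -_; _≤_)
  open import Data.Integer.Tactic.RingSolver using (solve-∀)

  sum-cong : ∀ n {f g : Fin n → ℤ} → (∀ i → f i ≡ g i) → sumFin n f ≡ sumFin n g
  sum-cong zero f≗g = refl
  sum-cong (suc n) f≗g = cong₂ _+_ (f≗g Fin.zero) (sum-cong n (λ i → f≗g (Fin.suc i)))

  sum-zero : ∀ n → sumFin n (λ _ → 0ℤ) ≡ 0ℤ
  sum-zero zero = refl
  sum-zero (suc n) = trans (ℤₚ.+-identityˡ _) (sum-zero n)

  sum-+ : ∀ n (f g : Fin n → ℤ) → sumFin n (λ i → f i + g i) ≡ sumFin n f + sumFin n g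
  sum-+ zero f g = refl
  sum-+ (suc n) f g =
    trans (cong (f Fin.zero + g Fin.zero +_) (sum-+ n (λ i → f (Fin.suc i)) (λ i → g (Fin.suc i))))
          (interchange (f Fin.zero) (g Fin.zero) _ _)
    where
    interchange : ∀ a b c d → (a + b) + (c + d) ≡ (a + c) + (b + d)
    interchange = solve-∀

  sum-*ˡ : ∀ n c (f : Fin n → ℤ) → sumFin n (λ i → c * f i) ≡ c * sumFin n f
  sum-*ˡ zero c f = sym (ℤₚ.*-zeroʳ c)
  sum-*ˡ (suc n) c f = trans (cong (c * f Fin.zero +_) (sum-*ˡ n c _)) (sym (ℤₚ.*-distribˡ-+ c _ _))

  sum-*ʳ : ∀ n c (f : Fin n → ℤ) → sumFin n (λ i → f i * c) ≡ sumFin n f * c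
  sum-*ʳ n c f = trans (sum-cong n (λ i → ℤₚ.*-comm (f i) c)) (trans (sum-*ˡ n c f) (ℤₚ.*-comm c _))

  sum-neg : ∀ n (f : Fin n → ℤ) → sumFin n (λ i → - f i) ≡ - sumFin n f
  sum-neg zero f = refl
  sum-neg (suc n) f = trans (cong (- f Fin.zero +_) (sum-neg n _)) (sym (ℤₚ.neg-distrib-+ (f Fin.zero) _))

  sum-comm : ∀ m n (f : Fin m → Fin n → ℤ) →
             sumFin m (λ i → sumFin n (f i)) ≡ sumFin n (λ j → sumFin m (λ i → f i j))
  sum-comm zero n f = sym (sum-zero n)
  sum-comm (suc m) n f = trans (cong (sumFin n (f Fin.zero) +_) (sum-comm m n _)) (sym (sum-+ n _ _))

  sumℕ : ℕ → (ℕ → ℤ) → ℤ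
  sumℕ zero f = 0ℤ
  sumℕ (suc k) f = f 0 + sumℕ k (λ a → f (suc a))

  sumℕ-cong : ∀ k {f g : ℕ → ℤ} → (∀ a → f a ≡ g a) → sumℕ k f ≡ sumℕ k g
  sumℕ-cong zero f≗g = refl
  sumℕ-cong (suc k) f≗g = cong₂ _+_ (f≗g 0) (sumℕ-cong k (λ a → f≗g (suc a)))

  sumℕ-zero : ∀ k {f : ℕ → ℤ} → (∀ a → f a ≡ 0ℤ) → sumℕ k f ≡ 0ℤ
  sumℕ-zero zero f≗0 = refl
  sumℕ-zero (suc k) f≗0 = cong₂ _+_ (f≗0 0) (sumℕ-zero k (λ a → f≗0 (suc a)))

  sumℕ-+ : ∀ k (f g : ℕ → ℤ) → sumℕ k (λ a → f a + g a) ≡ sumℕ k f + sumℕ k g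
  sumℕ-+ zero f g = refl
  sumℕ-+ (suc k) f g =
    trans (cong (f 0 + g 0 +_) (sumℕ-+ k (λ a → f (suc a)) (λ a → g (suc a))))
          (interchange (f 0) (g 0) _ _)
    where
    interchange : ∀ a b c d → (a + b) + (c + d) ≡ (a + c) + (b + d)
    interchange = solve-∀

  sumℕ-neg : ∀ k (f : ℕ → ℤ) → sumℕ k (λ a → - f a) ≡ - sumℕ k f
  sumℕ-neg zero f = refl
  sumℕ-neg (suc k) f = trans (cong (- f 0 +_) (sumℕ-neg k (λ a → f (suc a)))) (sym (ℤₚ.neg-distrib-+ (f 0) _))

  sumℕ-snoc : ∀ k (f : ℕ → ℤ) → sumℕ (suc k) f ≡ sumℕ k f + f k
  sumℕ-snoc zero f = ℤₚ.+-comm (f 0) 0ℤ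
  sumℕ-snoc (suc k) f = trans (cong (f 0 +_) (sumℕ-snoc k (λ a → f (suc a)))) (sym (ℤₚ.+-assoc (f 0) _ _))

  sumℕ-nonneg : ∀ k (f : ℕ → ℤ) → (∀ a → 0ℤ ≤ f a) → 0ℤ ≤ sumℕ k f
  sumℕ-nonneg zero f f≥0 = ℤₚ.≤-refl
  sumℕ-nonneg (suc k) f f≥0 = ℤₚ.+-mono-≤ (f≥0 0) (sumℕ-nonneg k (λ a → f (suc a)) (λ a → f≥0 (suc a)))

  sumℕ-rotate : ∀ L (G : ℕ → ℤ) → G L ≡ G 0 → sumℕ L (λ a → G (suc a)) ≡ sumℕ L G
  sumℕ-rotate L G G[L]≡G[0] = begin
    sumℕ L (λ a → G (suc a))                ≡⟨ add-cancel (G 0) _ ⟩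
    (G 0 + sumℕ L (λ a → G (suc a))) - G 0   ≡⟨ cong (_- G 0) (sumℕ-snoc L G) ⟩
    (sumℕ L G + G L) - G 0                   ≡⟨ cong (λ z → (sumℕ L G + z) - G 0) G[L]≡G[0] ⟩
    (sumℕ L G + G 0) - G 0                   ≡⟨ cancel-add (G 0) _ ⟩
    sumℕ L G                                 ∎
    where
    open ≡-Reasoning
    add-cancel : ∀ a x → x ≡ (a + x) - a
    add-cancel = solve-∀
    cancel-add : ∀ a x → (x + a) - a ≡ x
    cancel-add = solve-∀

  sumℕ-periodic : ∀ L (G : ℕ → ℤ) → (∀ a → G (a ℕ.+ L) ≡ G a) → ∀ t → sumℕ L (λ a → G (a ℕ.+ t)) ≡ sumℕ L G
  sumℕ-periodic L G periodic zero = sumℕ-cong L (λ a → cong G (ℕₚ.+-identityʳ a))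
  sumℕ-periodic L G periodic (suc t) =
    trans (sumℕ-cong L (λ a → cong G (ℕₚ.+-suc a t)))
          (trans (sumℕ-rotate L (λ a → G (a ℕ.+ t)) (trans (cong G (ℕₚ.+-comm L t)) (periodic t)))
                 (sumℕ-periodic L G periodic t))

  sumℕ-bilinear : ∀ k (P P′ Q Q′ : ℕ → ℤ) →
    sumℕ k (λ a → (P a - P′ a) * (Q a - Q′ a)) ≡
    (sumℕ k (λ a → P a * Q a) - sumℕ k (λ a → P′ a * Q a)) - (sumℕ k (λ a → P a * Q′ a) - sumℕ k (λ a → P′ a * Q′ a))
  sumℕ-bilinear k P P′ Q Q′ = begin
      sumℕ k (λ a → (P a - P′ a) * (Q a - Q′ a))
    ≡⟨ sumℕ-cong k (λ a → expand (P a) (P′ a) (Q a) (Q′ a)) ⟩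
      sumℕ k (λ a → (P a * Q a + - (P′ a * Q a)) + (- (P a * Q′ a) + P′ a * Q′ a))
    ≡⟨ sumℕ-+ k _ _ ⟩
      sumℕ k (λ a → P a * Q a + - (P′ a * Q a)) + sumℕ k (λ a → - (P a * Q′ a) + P′ a * Q′ a)
    ≡⟨ cong₂ _+_ (trans (sumℕ-+ k _ _) (cong (S P Q +_) (sumℕ-neg k _)))
                 (trans (sumℕ-+ k _ _) (cong (_+ S P′ Q′) (sumℕ-neg k _))) ⟩
      (S P Q - S P′ Q) + (- S P Q′ + S P′ Q′)
    ≡⟨ regroup (S P Q) (S P′ Q) (S P Q′) (S P′ Q′) ⟩
      (S P Q - S P′ Q) - (S P Q′ - S P′ Q′)
    ∎
    where
    open ≡-Reasoning
    S : (ℕ → ℤ) → (ℕ → ℤ) → ℤ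
    S f g = sumℕ k (λ a → f a * g a)
    expand : ∀ x x′ y y′ → (x - x′) * (y - y′) ≡ (x * y + - (x′ * y)) + (- (x * y′) + x′ * y′)
    expand = solve-∀
    regroup : ∀ a b c d → (a - b) + (- c + d) ≡ (a - b) - (c - d)
    regroup = solve-∀

  sum-δˡ : ∀ n (c : Fin n) (f : Fin n → ℤ) → sumFin n (λ k → δ k c * f k) ≡ f c
  sum-δˡ (suc n) Fin.zero f = begin
      δ {suc n} Fin.zero Fin.zero * f Fin.zero + sumFin n (λ k → δ (Fin.suc k) Fin.zero * f (Fin.suc k))
    ≡⟨ cong₂ _+_ (cong (_* f Fin.zero) (δ-refl {suc n} Fin.zero))
                 (sum-cong n (λ k → cong (_* f (Fin.suc k)) (δ-≢ {i = Fin.suc k} {Fin.zero} λ ()))) ⟩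
      1ℤ * f Fin.zero + sumFin n (λ k → 0ℤ * f (Fin.suc k))
    ≡⟨ cong₂ _+_ (ℤₚ.*-identityˡ (f Fin.zero)) (trans (sum-cong n (λ k → ℤₚ.*-zeroˡ (f (Fin.suc k)))) (sum-zero n)) ⟩
      f Fin.zero + 0ℤ
    ≡⟨ ℤₚ.+-identityʳ (f Fin.zero) ⟩
      f Fin.zero
    ∎
    where open ≡-Reasoning
  sum-δˡ (suc n) (Fin.suc c) f = begin
      δ Fin.zero (Fin.suc c) * f Fin.zero + sumFin n (λ k → δ (Fin.suc k) (Fin.suc c) * f (Fin.suc k))
    ≡⟨ cong₂ _+_ (cong (_* f Fin.zero) (δ-≢ {i = Fin.zero} {Fin.suc c} λ ()))
                 (sum-cong n (λ k → cong (_* f (Fin.suc k)) (δ-injective Fin.suc Finₚ.suc-injective k c))) ⟩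
      0ℤ * f Fin.zero + sumFin n (λ k → δ k c * f (Fin.suc k))
    ≡⟨ cong₂ _+_ (ℤₚ.*-zeroˡ (f Fin.zero)) (sum-δˡ n c (λ k → f (Fin.suc k))) ⟩
      0ℤ + f (Fin.suc c)
    ≡⟨ ℤₚ.+-identityˡ (f (Fin.suc c)) ⟩
      f (Fin.suc c)
    ∎
    where open ≡-Reasoning

  sum-δʳ : ∀ n (c : Fin n) (f : Fin n → ℤ) → sumFin n (λ k → f k * δ k c) ≡ f c
  sum-δʳ n c f = trans (sum-cong n (λ k → ℤₚ.*-comm (f k) _)) (sum-δˡ n c f)

  sum-permute : ∀ {m n} (π : Permutation m n) (f : Fin n → ℤ) → sumFin m (λ k → f (π ⟨$⟩ʳ k)) ≡ sumFin n f
  sum-permute {m} {n} π f = sym (begin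
      sumFin n f
    ≡⟨ sum-cong n (λ j → sym (trans (sum-δˡ m (π ⟨$⟩ˡ j) (λ k → f (π ⟨$⟩ʳ k))) (cong f (inverseʳ π)))) ⟩
      sumFin n (λ j → sumFin m (λ k → δ k (π ⟨$⟩ˡ j) * f (π ⟨$⟩ʳ k)))
    ≡⟨ sum-comm n m _ ⟩
      sumFin m (λ k → sumFin n (λ j → δ k (π ⟨$⟩ˡ j) * f (π ⟨$⟩ʳ k)))
    ≡⟨ sum-cong m (λ k → trans (sum-*ʳ n _ _) (cong (_* f (π ⟨$⟩ʳ k)) (column-sum k))) ⟩
      sumFin m (λ k → 1ℤ * f (π ⟨$⟩ʳ k))
    ≡⟨ sum-cong m (λ k → ℤₚ.*-identityˡ _) ⟩
      sumFin m (λ k → f (π ⟨$⟩ʳ k))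
    ∎)
    where
    open ≡-Reasoning
    δ-from : ∀ k j → δ k (π ⟨$⟩ˡ j) ≡ δ j (π ⟨$⟩ʳ k) * 1ℤ
    δ-from k j = begin
      δ k (π ⟨$⟩ˡ j)                       ≡⟨ sym (δ-injective (π ⟨$⟩ʳ_) (⟨$⟩ʳ-injective π) k _) ⟩
      δ (π ⟨$⟩ʳ k) (π ⟨$⟩ʳ (π ⟨$⟩ˡ j))     ≡⟨ cong (δ (π ⟨$⟩ʳ k)) (inverseʳ π) ⟩
      δ (π ⟨$⟩ʳ k) j                       ≡⟨ δ-sym _ j ⟩
      δ j (π ⟨$⟩ʳ k)                       ≡⟨ sym (ℤₚ.*-identityʳ _) ⟩
      δ j (π ⟨$⟩ʳ k) * 1ℤ                  ∎
    column-sum : ∀ k → sumFin n (λ j → δ k (π ⟨$⟩ˡ j)) ≡ 1ℤ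
    column-sum k = trans (sum-cong n (δ-from k)) (sum-δˡ n (π ⟨$⟩ʳ k) (λ _ → 1ℤ))

module Matrices where

  open Kronecker
  open Summation
  open import Data.Integer using (_*_)

  ≋-sym : ∀ {n} {A B : Matrix n} → A ≋ B → B ≋ A
  ≋-sym A≋B i j = sym (A≋B i j)

  ≋-trans : ∀ {n} {A B C : Matrix n} → A ≋ B → B ≋ C → A ≋ C
  ≋-trans A≋B B≋C i j = trans (A≋B i j) (B≋C i j)

  ⊗-congʳ : ∀ {n} (A : Matrix n) {B B′ : Matrix n} → B ≋ B′ → (A ⊗ B) ≋ (A ⊗ B′)
  ⊗-congʳ {n} A B≋B′ i j = sum-cong n (λ k → cong (A i k *_) (B≋B′ k j))

  ⊗-assoc : ∀ {n} (A B C : Matrix n) → ((A ⊗ B) ⊗ C) ≋ (A ⊗ (B ⊗ C))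
  ⊗-assoc {n} A B C i j = begin
      sumFin n (λ k → sumFin n (λ m → A i m * B m k) * C k j)
    ≡⟨ sum-cong n (λ k → sym (sum-*ʳ n (C k j) (λ m → A i m * B m k))) ⟩
      sumFin n (λ k → sumFin n (λ m → A i m * B m k * C k j))
    ≡⟨ sum-comm n n (λ k m → A i m * B m k * C k j) ⟩
      sumFin n (λ m → sumFin n (λ k → A i m * B m k * C k j))
    ≡⟨ sum-cong n (λ m → trans (sum-cong n (λ k → ℤₚ.*-assoc (A i m) (B m k) (C k j)))
                               (sum-*ˡ n (A i m) (λ k → B m k * C k j))) ⟩
      sumFin n (λ m → A i m * sumFin n (λ k → B m k * C k j))
    ∎
    where open ≡-Reasoning

  ⊗-identityˡ : ∀ {n} (A : Matrix n) → (identity ⊗ A) ≋ A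
  ⊗-identityˡ {n} A i j = trans (sum-cong n (λ k → cong (_* A k j) (δ-sym i k))) (sum-δˡ n i (λ k → A k j))

  ⊗-identityʳ : ∀ {n} (A : Matrix n) → (A ⊗ identity) ≋ A
  ⊗-identityʳ {n} A i j = sum-δʳ n j (A i)

  ^ₘ-commute : ∀ {n} (A : Matrix n) k → ((A ^ₘ k) ⊗ A) ≋ (A ⊗ (A ^ₘ k))
  ^ₘ-commute A zero = ≋-trans (⊗-identityˡ A) (≋-sym (⊗-identityʳ A))
  ^ₘ-commute A (suc k) = ≋-trans (⊗-assoc A (A ^ₘ k) A) (⊗-congʳ A (^ₘ-commute A k))

  transpose-⊗ : ∀ {n} (A B : Matrix n) → transpose (A ⊗ B) ≋ (transpose B ⊗ transpose A)
  transpose-⊗ {n} A B i j = sum-cong n (λ k → ℤₚ.*-comm (A j k) (B k i))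

  transpose-^ₘ : ∀ {n} (A : Matrix n) k → (transpose A ^ₘ k) ≋ transpose (A ^ₘ k)
  transpose-^ₘ A zero i j = δ-sym i j
  transpose-^ₘ A (suc k) =
    ≋-trans (⊗-congʳ (transpose A) (transpose-^ₘ A k))
            (≋-trans (≋-sym (transpose-⊗ (A ^ₘ k) A)) (λ i j → ^ₘ-commute A k j i))

  Relabelling : ∀ {m n} → Permutation m n → Matrix n → Matrix m → Set
  Relabelling π A B = ∀ x y → B x y ≡ A (π ⟨$⟩ʳ x) (π ⟨$⟩ʳ y)

  SameIdentityPowers : ∀ {m n} → Matrix n → Matrix m → Set
  SameIdentityPowers A B = ∀ k → (A ^ₘ k) ≋ identity ⇔ (B ^ₘ k) ≋ identity

  relabelling-^ₘ : ∀ {m n} {π : Permutation m n} {A B} → Relabelling π A B → ∀ k → Relabelling π (A ^ₘ k) (B ^ₘ k)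
  relabelling-^ₘ {π = π} B≡A zero x y = sym (δ-injective (π ⟨$⟩ʳ_) (⟨$⟩ʳ-injective π) x y)
  relabelling-^ₘ {m} {π = π} {A} {B} B≡A (suc k) x y =
    trans (sum-cong m (λ z → cong₂ _*_ (B≡A x z) (relabelling-^ₘ {π = π} {A} {B} B≡A k z y)))
          (sum-permute π (λ z → A (π ⟨$⟩ʳ x) z * (A ^ₘ k) z (π ⟨$⟩ʳ y)))

  relabelling⇒sameIdentityPowers : ∀ {m n} {π : Permutation m n} {A B} → Relabelling π A B → SameIdentityPowers A B
  relabelling⇒sameIdentityPowers {π = π} {A} {B} B≡A k = mk⇔ to from
    where
    Bᵏ≡Aᵏ : Relabelling π (A ^ₘ k) (B ^ₘ k)
    Bᵏ≡Aᵏ = relabelling-^ₘ {π = π} {A} {B} B≡A k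
    to : (A ^ₘ k) ≋ identity → (B ^ₘ k) ≋ identity
    to Aᵏ≋I x y = trans (Bᵏ≡Aᵏ x y) (trans (Aᵏ≋I _ _) (δ-injective (π ⟨$⟩ʳ_) (⟨$⟩ʳ-injective π) x y))
    from : (B ^ₘ k) ≋ identity → (A ^ₘ k) ≋ identity
    from Bᵏ≋I i j = begin
      (A ^ₘ k) i j                                          ≡⟨ sym (cong₂ (A ^ₘ k) (inverseʳ π) (inverseʳ π)) ⟩
      (A ^ₘ k) (π ⟨$⟩ʳ (π ⟨$⟩ˡ i)) (π ⟨$⟩ʳ (π ⟨$⟩ˡ j))      ≡⟨ sym (Bᵏ≡Aᵏ _ _) ⟩
      (B ^ₘ k) (π ⟨$⟩ˡ i) (π ⟨$⟩ˡ j)                        ≡⟨ Bᵏ≋I _ _ ⟩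
      δ (π ⟨$⟩ˡ i) (π ⟨$⟩ˡ j)                               ≡⟨ sym (δ-injective (π ⟨$⟩ʳ_) (⟨$⟩ʳ-injective π) _ _) ⟩
      δ (π ⟨$⟩ʳ (π ⟨$⟩ˡ i)) (π ⟨$⟩ʳ (π ⟨$⟩ˡ j))             ≡⟨ cong₂ δ (inverseʳ π) (inverseʳ π) ⟩
      δ i j                                                 ∎
      where open ≡-Reasoning

  conjugate-by-permMat : ∀ {n} (π : Permutation′ n) (A : Matrix n) x y →
    ((transpose (permMat π) ⊗ A) ⊗ permMat π) x y ≡ A (π ⟨$⟩ʳ x) (π ⟨$⟩ʳ y)
  conjugate-by-permMat {n} π A x y =
    trans (sum-cong n (λ m → cong (_* δ m (π ⟨$⟩ʳ y)) (sum-δˡ n (π ⟨$⟩ʳ x) (λ k → A k m))))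
          (sum-δʳ n (π ⟨$⟩ʳ y) (A (π ⟨$⟩ʳ x)))

  permSimilar⇒sameIdentityPowers : ∀ {n} {A B : Matrix n} → PermSimilar A B → SameIdentityPowers A B
  permSimilar⇒sameIdentityPowers {A = A} (π , B≋PᵀAP) =
    relabelling⇒sameIdentityPowers {π = π} (λ x y → trans (B≋PᵀAP x y) (conjugate-by-permMat π A x y))

  relabelling⇒permSimilar : ∀ {m n} (e : m ≡ n) (π : Permutation m n) {A : Matrix n} {B : Matrix m} →
    Relabelling π A B → PermSimilar A (subst Matrix e B)
  relabelling⇒permSimilar refl π {A} B≡A = π , λ x y → trans (B≡A x y) (sym (conjugate-by-permMat π A x y))

  transpose-sameIdentityPowers : ∀ {n} (A : Matrix n) → SameIdentityPowers A (transpose A)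
  transpose-sameIdentityPowers A k = mk⇔
    (λ Aᵏ≋I → ≋-trans (transpose-^ₘ A k) (λ i j → trans (Aᵏ≋I j i) (δ-sym j i)))
    (λ Aᵀᵏ≋I i j → trans (sym (transpose-^ₘ A k j i)) (trans (Aᵀᵏ≋I j i) (δ-sym j i)))

  multOrder-resp : ∀ {m n} {A : Matrix n} {B : Matrix m} {k} → SameIdentityPowers A B → MultOrder B k → MultOrder A k
  multOrder-resp {k = k} same (1≤k , Bᵏ≋I , least) =
    1≤k , Equivalence.from (same k) Bᵏ≋I , λ m 1≤m Aᵐ≋I → least m 1≤m (Equivalence.to (same m) Aᵐ≋I)

  hasFiniteOrder-resp : ∀ {m n} {A : Matrix n} {B : Matrix m} → SameIdentityPowers A B → HasFiniteOrder A → HasFiniteOrder B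
  hasFiniteOrder-resp same (k , 1≤k , Aᵏ≋I) = k , 1≤k , Equivalence.to (same k) Aᵏ≋I

module RankOnePerturbation where

  open Kronecker
  open Summation
  open Matrices using (Relabelling)
  open import Data.Integer using (_+_; _*_; _-_; -_)
  open import Data.Integer.Tactic.RingSolver using (solve-∀)

  rankOne : ∀ {n} (i₁ i₂ j₁ j₂ : Fin n) → Matrix n
  rankOne i₁ i₂ j₁ j₂ r c = (δ r i₁ - δ r i₂) * (δ c j₁ - δ c j₂)

  module Powers {n} (π : Permutation′ n) (i₁ i₂ j₁ j₂ : Fin n)
           (Tail : Fin n → Set) (π-Tail : ∀ {x} → Tail x → Tail (π ⟨$⟩ʳ x))
           (i₁-Tail : Tail i₁) (i₂-Tail : Tail i₂) (j₁-¬Tail : ¬ Tail j₁) (j₂-¬Tail : ¬ Tail j₂) where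

    α : ℕ → Fin n → ℤ
    α a r = δ r ((π ^ₚ a) i₁) - δ r ((π ^ₚ a) i₂)

    γ : ℕ → Fin n → ℤ
    γ a c = δ c ((π ^ₚ suc a) j₁) - δ c ((π ^ₚ suc a) j₂)

    powerFormula : ℕ → Matrix n
    powerFormula k r c = δ r ((π ^ₚ k) c) + sumℕ k (λ a → α a r * γ a ((π ^ₚ k) c))

    private
      M : Matrix n
      M = permMat π ⊕ₘ rankOne i₁ i₂ j₁ j₂

      ^ₚ-Tail : ∀ a {x} → Tail x → Tail ((π ^ₚ a) x)
      ^ₚ-Tail zero x-Tail = x-Tail
      ^ₚ-Tail (suc a) x-Tail = π-Tail (^ₚ-Tail a x-Tail)

      δ-Tail : ∀ a {x j} → Tail x → ¬ Tail j → δ j ((π ^ₚ a) x) ≡ 0ℤ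
      δ-Tail a x-Tail j-¬Tail = δ-≢ λ j≡ → j-¬Tail (subst Tail (sym j≡) (^ₚ-Tail a x-Tail))

      α-head : ∀ {j} → ¬ Tail j → ∀ a → α a j ≡ 0ℤ
      α-head j-¬Tail a = cong₂ _-_ (δ-Tail a i₁-Tail j-¬Tail) (δ-Tail a i₂-Tail j-¬Tail)

      powerFormula-head : ∀ {j} → ¬ Tail j → ∀ k c → powerFormula k j c ≡ δ j ((π ^ₚ k) c)
      powerFormula-head {j} j-¬Tail k c =
        trans (cong (δ j ((π ^ₚ k) c) +_)
                    (sumℕ-zero k (λ a → trans (cong (_* γ a ((π ^ₚ k) c)) (α-head j-¬Tail a))
                                              (ℤₚ.*-zeroˡ (γ a ((π ^ₚ k) c))))))
              (ℤₚ.+-identityʳ (δ j ((π ^ₚ k) c)))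

      δ-π : ∀ x y → δ (π ⟨$⟩ʳ x) (π ⟨$⟩ʳ y) ≡ δ x y
      δ-π = δ-injective (π ⟨$⟩ʳ_) (⟨$⟩ʳ-injective π)

      δ-π⁻¹ : ∀ r x → δ (π ⟨$⟩ˡ r) x ≡ δ r (π ⟨$⟩ʳ x)
      δ-π⁻¹ r x = trans (sym (δ-π (π ⟨$⟩ˡ r) x)) (cong (λ z → δ z (π ⟨$⟩ʳ x)) (inverseʳ π))

      permutation-part : ∀ k r c → sumFin n (λ m → δ r (π ⟨$⟩ʳ m) * powerFormula k m c) ≡
        δ r ((π ^ₚ suc k) c) + sumℕ k (λ a → α (suc a) r * γ (suc a) ((π ^ₚ suc k) c))
      permutation-part k r c =
        trans (sum-cong n (λ m → cong (_* powerFormula k m c) (trans (sym (δ-π⁻¹ r m)) (δ-sym (π ⟨$⟩ˡ r) m))))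
        (trans (sum-δˡ n (π ⟨$⟩ˡ r) (λ m → powerFormula k m c))
        (cong₂ _+_ (δ-π⁻¹ r _)
                   (sumℕ-cong k (λ a → cong₂ _*_ (cong₂ _-_ (δ-π⁻¹ r _) (δ-π⁻¹ r _))
                                                  (sym (cong₂ _-_ (δ-π _ _) (δ-π _ _)))))))

      rankOne-part : ∀ k r c → sumFin n (λ m → rankOne i₁ i₂ j₁ j₂ r m * powerFormula k m c) ≡
        α 0 r * γ 0 ((π ^ₚ suc k) c)
      rankOne-part k r c = begin
          sumFin n (λ m → (d * (δ m j₁ - δ m j₂)) * powerFormula k m c)
        ≡⟨ sum-cong n (λ m → split-column d (δ m j₁) (δ m j₂) (powerFormula k m c)) ⟩
          sumFin n (λ m → d * (δ m j₁ * powerFormula k m c + - (δ m j₂ * powerFormula k m c)))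
        ≡⟨ trans (sum-*ˡ n d (λ m → f₁ m + - f₂ m))
                 (cong (d *_) (trans (sum-+ n f₁ (λ m → - f₂ m)) (cong (sumFin n f₁ +_) (sum-neg n f₂)))) ⟩
          d * (sumFin n (λ m → δ m j₁ * powerFormula k m c) - sumFin n (λ m → δ m j₂ * powerFormula k m c))
        ≡⟨ cong (d *_) (cong₂ _-_ (sum-δˡ n j₁ _) (sum-δˡ n j₂ _)) ⟩
          d * (powerFormula k j₁ c - powerFormula k j₂ c)
        ≡⟨ cong (d *_) (cong₂ _-_ (head j₁-¬Tail) (head j₂-¬Tail)) ⟩
          d * γ 0 ((π ^ₚ suc k) c)
        ∎
        where
        open ≡-Reasoning
        d : ℤ
        d = δ r i₁ - δ r i₂
        f₁ f₂ : Fin n → ℤ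
        f₁ m = δ m j₁ * powerFormula k m c
        f₂ m = δ m j₂ * powerFormula k m c
        split-column : ∀ d x y f → (d * (x - y)) * f ≡ d * (x * f + - (y * f))
        split-column = solve-∀
        head : ∀ {j} → ¬ Tail j → powerFormula k j c ≡ δ (π ⟨$⟩ʳ ((π ^ₚ k) c)) (π ⟨$⟩ʳ j)
        head j-¬Tail = trans (powerFormula-head j-¬Tail k c) (trans (δ-sym _ _) (sym (δ-π _ _)))

      powerFormula-suc : ∀ k r c → sumFin n (λ m → M r m * powerFormula k m c) ≡ powerFormula (suc k) r c
      powerFormula-suc k r c = begin
          sumFin n (λ m → M r m * powerFormula k m c)
        ≡⟨ trans (sum-cong n (λ m → ℤₚ.*-distribʳ-+ (powerFormula k m c) (δ r (π ⟨$⟩ʳ m)) (rankOne i₁ i₂ j₁ j₂ r m)))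
                 (sum-+ n (λ m → δ r (π ⟨$⟩ʳ m) * powerFormula k m c)
                          (λ m → rankOne i₁ i₂ j₁ j₂ r m * powerFormula k m c)) ⟩
          sumFin n (λ m → δ r (π ⟨$⟩ʳ m) * powerFormula k m c)
            + sumFin n (λ m → rankOne i₁ i₂ j₁ j₂ r m * powerFormula k m c)
        ≡⟨ cong₂ _+_ (permutation-part k r c) (rankOne-part k r c) ⟩
          (δ r ((π ^ₚ suc k) c) + sumℕ k (λ a → α (suc a) r * γ (suc a) ((π ^ₚ suc k) c)))
            + α 0 r * γ 0 ((π ^ₚ suc k) c)
        ≡⟨ +-rotate (δ r ((π ^ₚ suc k) c)) (sumℕ k (λ a → α (suc a) r * γ (suc a) ((π ^ₚ suc k) c)))
                    (α 0 r * γ 0 ((π ^ₚ suc k) c)) ⟩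
          powerFormula (suc k) r c
        ∎
        where
        open ≡-Reasoning
        +-rotate : ∀ x y z → (x + y) + z ≡ x + (z + y)
        +-rotate = solve-∀

    ^ₘ-powerFormula : ∀ {A} → A ≋ (permMat π ⊕ₘ rankOne i₁ i₂ j₁ j₂) → ∀ k → (A ^ₘ k) ≋ powerFormula k
    ^ₘ-powerFormula A≋M zero r c = sym (ℤₚ.+-identityʳ (δ r c))
    ^ₘ-powerFormula A≋M (suc k) r c =
      trans (sum-cong n (λ m → cong₂ _*_ (A≋M r m) (^ₘ-powerFormula A≋M k m c))) (powerFormula-suc k r c)

  relabelling-permMat⊕rankOne : ∀ {m n} (ρ : Permutation m n) {τ : Permutation′ m} {σ : Permutation′ n} →
    (∀ y → ρ ⟨$⟩ʳ (τ ⟨$⟩ʳ y) ≡ σ ⟨$⟩ʳ (ρ ⟨$⟩ʳ y)) →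
    ∀ {I₁ I₂ J₁ J₂ i₁ i₂ j₁ j₂} → ρ ⟨$⟩ʳ I₁ ≡ i₁ → ρ ⟨$⟩ʳ I₂ ≡ i₂ → ρ ⟨$⟩ʳ J₁ ≡ j₁ → ρ ⟨$⟩ʳ J₂ ≡ j₂ →
    Relabelling ρ (permMat σ ⊕ₘ rankOne i₁ i₂ j₁ j₂) (permMat τ ⊕ₘ rankOne I₁ I₂ J₁ J₂)
  relabelling-permMat⊕rankOne ρ {τ} {σ} ρτ≡σρ {I₁} {I₂} {J₁} {J₂} ρI₁ ρI₂ ρJ₁ ρJ₂ x y = cong₂ _+_
    (trans (sym (δ-ρ x (τ ⟨$⟩ʳ y))) (cong (δ (ρ ⟨$⟩ʳ x)) (ρτ≡σρ y)))
    (cong₂ _*_ (cong₂ _-_ (δ-ρ′ x I₁ ρI₁) (δ-ρ′ x I₂ ρI₂)) (cong₂ _-_ (δ-ρ′ y J₁ ρJ₁) (δ-ρ′ y J₂ ρJ₂)))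
    where
    δ-ρ : ∀ x z → δ (ρ ⟨$⟩ʳ x) (ρ ⟨$⟩ʳ z) ≡ δ x z
    δ-ρ = δ-injective (ρ ⟨$⟩ʳ_) (⟨$⟩ʳ-injective ρ)
    δ-ρ′ : ∀ x Z {z} → ρ ⟨$⟩ʳ Z ≡ z → δ x Z ≡ δ (ρ ⟨$⟩ʳ x) z
    δ-ρ′ x Z refl = sym (δ-ρ x Z)

module Permutations where

  open import Data.Nat using (_+_; _*_; NonZero)
  open import Data.Nat.DivMod
    using (_%_; _/_; m%n<n; m%n%n≡m%n; %-distribˡ-+; [m+n]%n≡m%n; [m+kn]%n≡m%n; m<n⇒m%n≡m; m≡m%n+[m/n]*n)
  open import Data.Nat.Divisibility using (_∣_; divides)
  open import Data.Fin.Properties using (+↔⊎; toℕ-injective; toℕ-fromℕ<; toℕ<n; toℕ-↑ˡ; toℕ-↑ʳ;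
                                         splitAt-↑ˡ; splitAt-↑ʳ; splitAt⁻¹-↑ˡ; splitAt⁻¹-↑ʳ)
  open import Data.Sum.Function.Propositional using (_⊎-↔_)
  open import Function.Construct.Composition using (_↔-∘_)
  open import Function.Construct.Symmetry using (↔-sym)

  ^ₚ-+ : ∀ {n} (π : Permutation′ n) a b x → (π ^ₚ (a + b)) x ≡ (π ^ₚ a) ((π ^ₚ b) x)
  ^ₚ-+ π zero b x = refl
  ^ₚ-+ π (suc a) b x = cong (π ⟨$⟩ʳ_) (^ₚ-+ π a b x)

  ^ₚ-injective : ∀ {n} (π : Permutation′ n) a {x y} → (π ^ₚ a) x ≡ (π ^ₚ a) y → x ≡ y
  ^ₚ-injective π zero πᵃx≡πᵃy = πᵃx≡πᵃy
  ^ₚ-injective π (suc a) πᵃx≡πᵃy = ^ₚ-injective π a (⟨$⟩ʳ-injective π πᵃx≡πᵃy)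

  ^ₚ-*-fixed : ∀ {n} (π : Permutation′ n) N {x} → (π ^ₚ N) x ≡ x → ∀ w → (π ^ₚ (w * N)) x ≡ x
  ^ₚ-*-fixed π N πᴺx≡x zero = refl
  ^ₚ-*-fixed π N {x} πᴺx≡x (suc w) =
    trans (^ₚ-+ π N (w * N) x) (trans (cong (π ^ₚ N) (^ₚ-*-fixed π N πᴺx≡x w)) πᴺx≡x)

  ^ₚ-% : ∀ {n} (π : Permutation′ n) N .{{_ : NonZero N}} {x} → (π ^ₚ N) x ≡ x → ∀ k → (π ^ₚ k) x ≡ (π ^ₚ (k % N)) x
  ^ₚ-% π N {x} πᴺx≡x k = begin
    (π ^ₚ k) x                                   ≡⟨ cong (λ m → (π ^ₚ m) x) (m≡m%n+[m/n]*n k N) ⟩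
    (π ^ₚ (k % N + k / N * N)) x                  ≡⟨ ^ₚ-+ π (k % N) (k / N * N) x ⟩
    (π ^ₚ (k % N)) ((π ^ₚ (k / N * N)) x)         ≡⟨ cong (π ^ₚ (k % N)) (^ₚ-*-fixed π N πᴺx≡x (k / N)) ⟩
    (π ^ₚ (k % N)) x                             ∎
    where open ≡-Reasoning

  _⊕ₚ_ : ∀ {p q} → Permutation′ p → Permutation′ q → Permutation′ (p + q)
  π ⊕ₚ ρ = ↔-sym +↔⊎ ↔-∘ ((π ⊎-↔ ρ) ↔-∘ +↔⊎)

  ↑ˡ≢↑ʳ : ∀ {p q} (u : Fin p) (v : Fin q) → ¬ u ↑ˡ q ≡ p ↑ʳ v
  ↑ˡ≢↑ʳ {p} {q} u v u≡v = ℕₚ.<⇒≢ (ℕₚ.<-≤-trans (toℕ<n u) (ℕₚ.m≤m+n p (toℕ v)))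
    (trans (sym (toℕ-↑ˡ u q)) (trans (cong toℕ u≡v) (toℕ-↑ʳ p v)))

  data Split (p q : ℕ) : Fin (p + q) → Set where
    left : ∀ u → Split p q (u ↑ˡ q)
    right : ∀ v → Split p q (p ↑ʳ v)

  split : ∀ p q (r : Fin (p + q)) → Split p q r
  split p q r with splitAt p r in eq
  ... | inj₁ u = subst (Split p q) (splitAt⁻¹-↑ˡ eq) (left u)
  ... | inj₂ v = subst (Split p q) (splitAt⁻¹-↑ʳ eq) (right v)

  module _ {p q} (π : Permutation′ p) (ρ : Permutation′ q) where

    ^ₚ-⊕ₚ-↑ˡ : ∀ a (u : Fin p) → ((π ⊕ₚ ρ) ^ₚ a) (u ↑ˡ q) ≡ (π ^ₚ a) u ↑ˡ q
    ^ₚ-⊕ₚ-↑ˡ zero u = refl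
    ^ₚ-⊕ₚ-↑ˡ (suc a) u = trans (cong ((π ⊕ₚ ρ) ⟨$⟩ʳ_) (^ₚ-⊕ₚ-↑ˡ a u))
                               (cong (join p q ∘ Sum.map (π ⟨$⟩ʳ_) (ρ ⟨$⟩ʳ_)) (splitAt-↑ˡ p _ q))

    ^ₚ-⊕ₚ-↑ʳ : ∀ a (v : Fin q) → ((π ⊕ₚ ρ) ^ₚ a) (p ↑ʳ v) ≡ p ↑ʳ (ρ ^ₚ a) v
    ^ₚ-⊕ₚ-↑ʳ zero v = refl
    ^ₚ-⊕ₚ-↑ʳ (suc a) v = trans (cong ((π ⊕ₚ ρ) ⟨$⟩ʳ_) (^ₚ-⊕ₚ-↑ʳ a v))
                               (cong (join p q ∘ Sum.map (π ⟨$⟩ʳ_) (ρ ⟨$⟩ʳ_)) (splitAt-↑ʳ p q _))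

  private
    toℕ-mod : ∀ k (u : Fin (suc k)) → toℕ u % suc k ≡ toℕ u
    toℕ-mod k u = m<n⇒m%n≡m (toℕ<n u)

    %-absorbʳ : ∀ a b N .{{_ : NonZero N}} → (a + b % N) % N ≡ (a + b) % N
    %-absorbʳ a b N = begin
      (a + b % N) % N                ≡⟨ %-distribˡ-+ a (b % N) N ⟩
      (a % N + b % N % N) % N        ≡⟨ cong (λ z → (a % N + z) % N) (m%n%n≡m%n b N) ⟩
      (a % N + b % N) % N            ≡⟨ sym (%-distribˡ-+ a b N) ⟩
      (a + b) % N                    ∎
      where open ≡-Reasoning

    rotate : ∀ k → Fin (suc k) → Fin (suc k)
    rotate k u = fromℕ< (m%n<n (suc (toℕ u)) (suc k))

    rotate⁻¹ : ∀ k → Fin (suc k) → Fin (suc k)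
    rotate⁻¹ k u = fromℕ< (m%n<n (toℕ u + k) (suc k))

    rotate-rotate⁻¹ : ∀ k u → rotate k (rotate⁻¹ k u) ≡ u
    rotate-rotate⁻¹ k u = toℕ-injective (begin
      toℕ (rotate k (rotate⁻¹ k u))          ≡⟨ toℕ-fromℕ< _ ⟩
      suc (toℕ (rotate⁻¹ k u)) % suc k       ≡⟨ cong (λ z → suc z % suc k) (toℕ-fromℕ< _) ⟩
      (1 + (toℕ u + k) % suc k) % suc k      ≡⟨ %-absorbʳ 1 (toℕ u + k) (suc k) ⟩
      suc (toℕ u + k) % suc k                ≡⟨ cong (_% suc k) (sym (ℕₚ.+-suc (toℕ u) k)) ⟩
      (toℕ u + suc k) % suc k                ≡⟨ [m+n]%n≡m%n (toℕ u) (suc k) ⟩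
      toℕ u % suc k                          ≡⟨ toℕ-mod k u ⟩
      toℕ u                                  ∎)
      where open ≡-Reasoning

    rotate⁻¹-rotate : ∀ k u → rotate⁻¹ k (rotate k u) ≡ u
    rotate⁻¹-rotate k u = toℕ-injective (begin
      toℕ (rotate⁻¹ k (rotate k u))          ≡⟨ toℕ-fromℕ< _ ⟩
      (toℕ (rotate k u) + k) % suc k         ≡⟨ cong (λ z → (z + k) % suc k) (toℕ-fromℕ< (m%n<n (suc (toℕ u)) (suc k))) ⟩
      (suc (toℕ u) % suc k + k) % suc k      ≡⟨ cong (_% suc k) (ℕₚ.+-comm (suc (toℕ u) % suc k) k) ⟩
      (k + suc (toℕ u) % suc k) % suc k      ≡⟨ %-absorbʳ k (suc (toℕ u)) (suc k) ⟩
      (k + suc (toℕ u)) % suc k              ≡⟨ cong (_% suc k) (trans (ℕₚ.+-comm k (suc (toℕ u))) (sym (ℕₚ.+-suc (toℕ u) k))) ⟩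
      (toℕ u + suc k) % suc k                ≡⟨ [m+n]%n≡m%n (toℕ u) (suc k) ⟩
      toℕ u % suc k                          ≡⟨ toℕ-mod k u ⟩
      toℕ u                                  ∎)
      where open ≡-Reasoning

  rotation : ∀ k → Permutation′ (suc k)
  rotation k = permutation (rotate k) (rotate⁻¹ k) (rotate-rotate⁻¹ k) (rotate⁻¹-rotate k)

  toℕ-rotation : ∀ k (u : Fin (suc k)) → toℕ (rotation k ⟨$⟩ʳ u) ≡ suc (toℕ u) % suc k
  toℕ-rotation k u = toℕ-fromℕ< _

  toℕ-rotation^ₚ : ∀ k a (u : Fin (suc k)) → toℕ ((rotation k ^ₚ a) u) ≡ (toℕ u + a) % suc k
  toℕ-rotation^ₚ k zero u = trans (sym (toℕ-mod k u)) (cong (_% suc k) (sym (ℕₚ.+-identityʳ (toℕ u))))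
  toℕ-rotation^ₚ k (suc a) u = begin
    toℕ (rotation k ⟨$⟩ʳ (rotation k ^ₚ a) u)  ≡⟨ toℕ-rotation k _ ⟩
    suc (toℕ ((rotation k ^ₚ a) u)) % suc k    ≡⟨ cong (λ z → suc z % suc k) (toℕ-rotation^ₚ k a u) ⟩
    (1 + (toℕ u + a) % suc k) % suc k          ≡⟨ %-absorbʳ 1 (toℕ u + a) (suc k) ⟩
    suc (toℕ u + a) % suc k                    ≡⟨ cong (_% suc k) (sym (ℕₚ.+-suc (toℕ u) a)) ⟩
    (toℕ u + suc a) % suc k                    ∎
    where open ≡-Reasoning

  rotation^ₚ-multiple : ∀ k {a} → suc k ∣ a → ∀ u → (rotation k ^ₚ a) u ≡ u
  rotation^ₚ-multiple k {a} (divides w a≡w*n) u = toℕ-injective (begin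
    toℕ ((rotation k ^ₚ a) u)     ≡⟨ toℕ-rotation^ₚ k a u ⟩
    (toℕ u + a) % suc k          ≡⟨ cong (λ z → (toℕ u + z) % suc k) a≡w*n ⟩
    (toℕ u + w * suc k) % suc k  ≡⟨ [m+kn]%n≡m%n (toℕ u) w (suc k) ⟩
    toℕ u % suc k                ≡⟨ toℕ-mod k u ⟩
    toℕ u                        ∎)
    where open ≡-Reasoning

module PermutationMatrices where

  open Kronecker
  open Permutations
  open RankOnePerturbation using (rankOne)
  open import Data.Integer using (_+_; _*_; _-_)
  open import Data.Integer.Tactic.RingSolver using (solve-∀)
  open import Data.Bool using (_∨_)
  open import Data.Nat.DivMod using (m<n⇒m%n≡m; n%n≡0)
  open import Data.Fin.Properties using (toℕ-injective; toℕ<n; ↑ˡ-injective; ↑ʳ-injective; splitAt⁻¹-↑ˡ; splitAt⁻¹-↑ʳ)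
  open import Relation.Nullary.Decidable using (_×-dec_; _⊎-dec_)

  permMat-⊕ₚ : ∀ {p q} (π : Permutation′ p) (ρ : Permutation′ q) → (permMat π ⊞ permMat ρ) ≋ permMat (π ⊕ₚ ρ)
  permMat-⊕ₚ {p} {q} π ρ r c with splitAt p r in r≡ | splitAt p c
  ... | inj₁ u | inj₁ v = sym (trans (cong (λ x → δ x ((π ⟨$⟩ʳ v) ↑ˡ q)) (sym (splitAt⁻¹-↑ˡ r≡)))
                                     (δ-injective (_↑ˡ q) (↑ˡ-injective q _ _) u _))
  ... | inj₂ u | inj₂ v = sym (trans (cong (λ x → δ x (p ↑ʳ (ρ ⟨$⟩ʳ v))) (sym (splitAt⁻¹-↑ʳ r≡)))
                                     (δ-injective (p ↑ʳ_) (↑ʳ-injective p _ _) u _))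
  ... | inj₁ u | inj₂ v = sym (δ-≢ λ r≡v → ↑ˡ≢↑ʳ u _ (trans (splitAt⁻¹-↑ˡ r≡) r≡v))
  ... | inj₂ u | inj₁ v = sym (δ-≢ λ r≡v → ↑ˡ≢↑ʳ _ u (sym (trans (splitAt⁻¹-↑ʳ r≡) r≡v)))

  private
    ≡rotate⇔ : ∀ k (u v : Fin (suc k)) →
      (u ≡ rotation k ⟨$⟩ʳ v) ⇔ (suc (toℕ u) ≡ suc (suc (toℕ v)) ⊎ (suc (toℕ u) ≡ 1 × suc (toℕ v) ≡ suc k))
    ≡rotate⇔ k u v = mk⇔ to from
      where
      steps : toℕ v ℕ.< k → toℕ (rotation k ⟨$⟩ʳ v) ≡ suc (toℕ v)
      steps v<k = trans (toℕ-rotation k v) (m<n⇒m%n≡m (ℕ.s≤s v<k))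
      wraps : toℕ v ≡ k → toℕ (rotation k ⟨$⟩ʳ v) ≡ 0
      wraps v≡k = trans (toℕ-rotation k v) (trans (cong (λ z → suc z ℕ.% suc k) v≡k) (n%n≡0 (suc k)))
      to : u ≡ rotation k ⟨$⟩ʳ v → _
      to refl with ℕₚ.m≤n⇒m<n∨m≡n (ℕ.s≤s⁻¹ (toℕ<n v))
      ... | inj₁ v<k = inj₁ (cong suc (steps v<k))
      ... | inj₂ v≡k = inj₂ (cong suc (wraps v≡k) , cong suc v≡k)
      from : _ → u ≡ rotation k ⟨$⟩ʳ v
      from (inj₁ u≡1+v) = toℕ-injective (trans (ℕₚ.suc-injective u≡1+v)
        (sym (steps (ℕ.s≤s⁻¹ (subst (ℕ._< suc k) (ℕₚ.suc-injective u≡1+v) (toℕ<n u))))))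
      from (inj₂ (u≡0 , v≡k)) = toℕ-injective (trans (ℕₚ.suc-injective u≡0) (sym (wraps (ℕₚ.suc-injective v≡k))))

    ∨-⊎-dec : ∀ {a b} {A : Set a} {B : Set b} (a? : Dec A) (b? : Dec B) → ⌊ a? ⌋ ∨ ⌊ b? ⌋ ≡ ⌊ a? ⊎-dec b? ⌋
    ∨-⊎-dec (yes _) _ = refl
    ∨-⊎-dec (no _) (yes _) = refl
    ∨-⊎-dec (no _) (no _) = refl

  ⊞-cong : ∀ {p q} {A A′ : Matrix p} {B B′ : Matrix q} → A ≋ A′ → B ≋ B′ → (A ⊞ B) ≋ (A′ ⊞ B′)
  ⊞-cong {p} A≋A′ B≋B′ r c with splitAt p r | splitAt p c
  ... | inj₁ u | inj₁ v = A≋A′ u v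
  ... | inj₂ u | inj₂ v = B≋B′ u v
  ... | inj₁ _ | inj₂ _ = refl
  ... | inj₂ _ | inj₁ _ = refl

  C-rotation : ∀ k → C (suc k) ≋ permMat (rotation k)
  C-rotation k u v = trans (cong ind (∨-⊎-dec steps? wraps?))
    (ind-cong (steps? ⊎-dec wraps?) (u Fin.≟ rotation k ⟨$⟩ʳ v)
              (Equivalence.from (≡rotate⇔ k u v)) (Equivalence.to (≡rotate⇔ k u v)))
    where
    steps? : Dec (suc (toℕ u) ≡ suc (suc (toℕ v)))
    steps? = suc (toℕ u) ℕ.≟ suc (suc (toℕ v))
    wraps? : Dec (suc (toℕ u) ≡ 1 × suc (toℕ v) ≡ suc k)
    wraps? = (suc (toℕ u) ℕ.≟ 1) ×-dec (suc (toℕ v) ℕ.≟ suc k)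

  private
    ind-×-dec : ∀ {a b} {A : Set a} {B : Set b} (a? : Dec A) (b? : Dec B) → ind ⌊ a? ×-dec b? ⌋ ≡ ind ⌊ a? ⌋ * ind ⌊ b? ⌋
    ind-×-dec (yes _) (yes _) = refl
    ind-×-dec (yes _) (no _) = refl
    ind-×-dec (no _) (yes _) = refl
    ind-×-dec (no _) (no _) = refl

    Tblock-entry : ∀ {N} (r c A B : Fin N) {a b} → idx A ≡ a → idx B ≡ b →
      ind ⌊ (idx r ℕ.≟ a) ×-dec (idx c ℕ.≟ b) ⌋ ≡ δ r A * δ c B
    Tblock-entry r c A B refl refl = trans (ind-×-dec (idx r ℕ.≟ idx A) (idx c ℕ.≟ idx B)) (cong₂ _*_
      (ind-cong (idx r ℕ.≟ idx A) (r Fin.≟ A) (λ e → toℕ-injective (ℕₚ.suc-injective e)) (cong idx))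
      (ind-cong (idx c ℕ.≟ idx B) (c Fin.≟ B) (λ e → toℕ-injective (ℕₚ.suc-injective e)) (cong idx)))

  Tblock-rankOne : ∀ {N} (i₁ j₁ i₂ j₂ : Fin N) {a b c d} → idx i₁ ≡ a → idx j₁ ≡ b → idx i₂ ≡ c → idx j₂ ≡ d →
    Tblock N a b c d ≋ rankOne i₁ i₂ j₁ j₂
  Tblock-rankOne i₁ j₁ i₂ j₂ ≡a ≡b ≡c ≡d r m =
    trans (cong₂ _-_ (cong₂ _-_ (cong₂ _+_ (Tblock-entry r m i₁ j₁ ≡a ≡b) (Tblock-entry r m i₂ j₂ ≡c ≡d))
                                (Tblock-entry r m i₁ j₂ ≡a ≡d))
                     (Tblock-entry r m i₂ j₁ ≡c ≡b))
          (expand (δ r i₁) (δ r i₂) (δ m j₁) (δ m j₂))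
    where
    expand : ∀ x₁ x₂ y₁ y₂ → x₁ * y₁ + x₂ * y₂ - x₁ * y₂ - x₂ * y₁ ≡ (x₁ - x₂) * (y₁ - y₂)
    expand = solve-∀

module Arithmetic where

  open import Data.Nat using (_+_; _*_; _≤_; NonZero)
  open import Data.Nat.DivMod using (_%_; [m+kn]%n≡m%n)
  open import Data.Nat.GCD using (gcd; gcd-GCD; module Bézout)
  open import Data.Nat.Divisibility using (_∣_; divides)
  open import Data.Nat.Tactic.RingSolver using (solve-∀)
  open Bézout.Identity using (+-; -+)

  %-shift : ∀ N .{{_ : NonZero N}} {x x′ t} w → x + t ≡ x′ + w * N → ∀ a → (x + (a + t)) % N ≡ (x′ + a) % N
  %-shift N {x} {x′} {t} w x+t≡ a = begin
    (x + (a + t)) % N            ≡⟨ cong (_% N) (shuffle x a t) ⟩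
    (x + t + a) % N              ≡⟨ cong (λ z → (z + a) % N) x+t≡ ⟩
    (x′ + w * N + a) % N         ≡⟨ cong (_% N) (reorder x′ (w * N) a) ⟩
    (x′ + a + w * N) % N         ≡⟨ [m+kn]%n≡m%n (x′ + a) w N ⟩
    (x′ + a) % N                 ∎
    where
    open ≡-Reasoning
    shuffle : ∀ x a t → x + (a + t) ≡ x + t + a
    shuffle = solve-∀
    reorder : ∀ x y z → x + y + z ≡ x + z + y
    reorder = solve-∀

  private
    -- From x + qW = pW′ we get x + p (W′ (q - 1)) = q (pW′ - W); Z stands for pW′ - W.
    swap-sides : ∀ p q′ x W W′ → x + suc q′ * W ≡ p * W′ → ∃₂ λ w w′ → x + p * w ≡ suc q′ * w′
    swap-sides p q′ x W W′ eq = W′ * q′ , Z , ℕₚ.+-cancelʳ-≡ (q * W) (x + p * (W′ * q′)) (q * Z) (begin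
        x + p * (W′ * q′) + q * W    ≡⟨ l₁ x p W′ q′ (q * W) ⟩
        (x + q * W) + p * (W′ * q′)  ≡⟨ cong (_+ p * (W′ * q′)) eq ⟩
        p * W′ + p * (W′ * q′)       ≡⟨ l₂ p W′ q′ ⟩
        q * (p * W′)                 ≡⟨ cong (q *_) (sym W+Z≡) ⟩
        q * (W + Z)                  ≡⟨ l₃ q W Z ⟩
        q * Z + q * W                ∎)
      where
      open ≡-Reasoning
      q : ℕ
      q = suc q′
      W≤pW′ : W ≤ p * W′
      W≤pW′ = ℕₚ.≤-trans (ℕₚ.m≤n*m W q) (ℕₚ.≤-trans (ℕₚ.m≤n+m (q * W) x) (ℕₚ.≤-reflexive eq))
      Z : ℕ
      Z = proj₁ (ℕₚ.m≤n⇒∃[o]m+o≡n W≤pW′)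
      W+Z≡ : W + Z ≡ p * W′
      W+Z≡ = proj₂ (ℕₚ.m≤n⇒∃[o]m+o≡n W≤pW′)
      l₁ : ∀ x p W′ q′ y → x + p * (W′ * q′) + y ≡ (x + y) + p * (W′ * q′)
      l₁ = solve-∀
      l₂ : ∀ p W′ q′ → p * W′ + p * (W′ * q′) ≡ suc q′ * (p * W′)
      l₂ = solve-∀
      l₃ : ∀ q W Z → q * (W + Z) ≡ q * Z + q * W
      l₃ = solve-∀

  gcd∣⇒∃x+p*w≡q*w′ : ∀ p q x → 1 ≤ q → gcd p q ∣ x → ∃₂ λ w w′ → x + p * w ≡ q * w′
  gcd∣⇒∃x+p*w≡q*w′ p (suc q′) x _ (divides c x≡cg) with Bézout.identity (gcd-GCD p (suc q′))
  ... | -+ a b g+ap≡bq = c * a , c * b , (begin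
      x + p * (c * a)              ≡⟨ cong (_+ p * (c * a)) x≡cg ⟩
      c * g + p * (c * a)          ≡⟨ l₁ c g p a ⟩
      c * (g + a * p)              ≡⟨ cong (c *_) g+ap≡bq ⟩
      c * (b * suc q′)             ≡⟨ l₂ c b (suc q′) ⟩
      suc q′ * (c * b)             ∎)
    where
    open ≡-Reasoning
    g : ℕ
    g = gcd p (suc q′)
    l₁ : ∀ c g p a → c * g + p * (c * a) ≡ c * (g + a * p)
    l₁ = solve-∀
    l₂ : ∀ c b q → c * (b * q) ≡ q * (c * b)
    l₂ = solve-∀
  ... | +- a b g+bq≡ap = swap-sides p q′ x (c * b) (c * a) (begin
      x + suc q′ * (c * b)         ≡⟨ cong (_+ suc q′ * (c * b)) x≡cg ⟩
      c * g + suc q′ * (c * b)     ≡⟨ l₁ c g (suc q′) b ⟩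
      c * (g + b * suc q′)         ≡⟨ cong (c *_) g+bq≡ap ⟩
      c * (a * p)                  ≡⟨ l₂ c a p ⟩
      p * (c * a)                  ∎)
    where
    open ≡-Reasoning
    g : ℕ
    g = gcd p (suc q′)
    l₁ : ∀ c g q b → c * g + q * (c * b) ≡ c * (g + b * q)
    l₁ = solve-∀
    l₂ : ∀ c a p → c * (a * p) ≡ p * (c * a)
    l₂ = solve-∀

module Target (p′ q′ h l : ℕ) (1≤h : 1 ℕ.≤ h) (h<p : h ℕ.< suc p′) (1≤l : 1 ℕ.≤ l) (l<q : l ℕ.< suc q′) where

  open Kronecker
  open Summation
  open Matrices
  open RankOnePerturbation
  open Permutations
  open PermutationMatrices
  open Arithmetic
  open import Data.Integer using (_+_; _*_; _-_; _≤_; +≤+)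
  open import Relation.Nullary.Decidable using (decidable-stable; _⊎-dec_)
  open import Data.Nat.DivMod using (_%_; m<n⇒m%n≡m; n%n≡0)
  open import Data.Nat.GCD using (gcd; gcd-comm; gcd[m,n]∣m; gcd[m,n]∣n)
  open import Data.Nat.LCM using (lcm; m∣lcm[m,n]; n∣lcm[m,n]; lcm-least; gcd*lcm)
  open import Data.Nat.Divisibility using (_∣_; _∣?_; m%n≡0⇒n∣m; ∣m+n∣m⇒∣n; ∣-trans; ∣⇒≤)
  open import Data.Nat.Tactic.RingSolver renaming (solve-∀ to solveℕ)
  open import Data.Fin.Properties using (toℕ-injective; toℕ-fromℕ<; toℕ-fromℕ; toℕ-↑ˡ; toℕ-↑ʳ; ↑ˡ-injective; ↑ʳ-injective)

  p q : ℕ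
  p = suc p′
  q = suc q′

  τ : Permutation′ (p ℕ.+ q)
  τ = rotation p′ ⊕ₚ rotation q′

  -- J₂ is column p + m₀ in the paper's 1-based numbering.
  m₀ : ℕ
  m₀ = suc (q′ ℕ.∸ l)

  m₀+l≡q : m₀ ℕ.+ l ≡ q
  m₀+l≡q = cong suc (ℕₚ.m∸n+n≡m (ℕ.s≤s⁻¹ l<q))

  I₁ I₂ J₁ J₂ : Fin (p ℕ.+ q)
  I₁ = Fin.zero ↑ˡ q
  I₂ = fromℕ< h<p ↑ˡ q
  J₁ = p ↑ʳ Fin.fromℕ q′
  J₂ = p ↑ʳ J₂-offset
    where
    J₂-offset : Fin q
    J₂-offset = fromℕ< (ℕ.s≤s (ℕₚ.m∸n≤m q′ l))

  Left : Fin (p ℕ.+ q) → Set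
  Left r = Σ (Fin p) λ u → r ≡ u ↑ˡ q

  τ-Left : ∀ {r} → Left r → Left (τ ⟨$⟩ʳ r)
  τ-Left (u , refl) = rotation p′ ⟨$⟩ʳ u , ^ₚ-⊕ₚ-↑ˡ (rotation p′) (rotation q′) 1 u

  right-¬Left : ∀ v → ¬ Left (p ↑ʳ v)
  right-¬Left v (u , v≡u) = ↑ˡ≢↑ʳ u v (sym v≡u)

  open Powers τ I₁ I₂ J₁ J₂ Left τ-Left (Fin.zero , refl) (fromℕ< h<p , refl) (right-¬Left _) (right-¬Left _)

  target≋ : target p q h l ≋ (permMat τ ⊕ₘ rankOne I₁ I₂ J₁ J₂)
  target≋ r c = cong₂ _+_
    (trans (⊞-cong (C-rotation p′) (C-rotation q′) r c) (permMat-⊕ₚ (rotation p′) (rotation q′) r c))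
    (Tblock-rankOne I₁ J₁ I₂ J₂ idx-I₁ idx-J₁ idx-I₂ idx-J₂ r c)
    where
    idx-I₁ : idx I₁ ≡ 1
    idx-I₁ = cong suc (toℕ-↑ˡ (Fin.zero {p′}) q)
    idx-J₁ : idx J₁ ≡ p ℕ.+ q
    idx-J₁ = trans (cong suc (trans (toℕ-↑ʳ p _) (cong (p ℕ.+_) (toℕ-fromℕ q′)))) (sym (ℕₚ.+-suc p q′))
    idx-I₂ : idx I₂ ≡ suc h
    idx-I₂ = cong suc (trans (toℕ-↑ˡ _ q) (toℕ-fromℕ< h<p))
    idx-J₂ : idx J₂ ≡ (p ℕ.+ q) ℕ.∸ l
    idx-J₂ = begin
      suc (toℕ J₂)                ≡⟨ cong suc (trans (toℕ-↑ʳ p _) (cong (p ℕ.+_) (toℕ-fromℕ< _))) ⟩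
      suc (p ℕ.+ (q′ ℕ.∸ l))      ≡⟨ sym (ℕₚ.+-suc p (q′ ℕ.∸ l)) ⟩
      p ℕ.+ m₀                    ≡⟨ cong (p ℕ.+_) (sym (ℕₚ.+-∸-assoc 1 (ℕ.s≤s⁻¹ l<q))) ⟩
      p ℕ.+ (q ℕ.∸ l)             ≡⟨ sym (ℕₚ.+-∸-assoc p (ℕₚ.<⇒≤ l<q)) ⟩
      (p ℕ.+ q) ℕ.∸ l             ∎
      where open ≡-Reasoning

  target^ₘ : ∀ k → (target p q h l ^ₘ k) ≋ powerFormula k
  target^ₘ = ^ₘ-powerFormula target≋

  δℕ : ℕ → ℕ → ℤ
  δℕ x y = ind ⌊ x ℕ.≟ y ⌋

  private
    δ-toℕ : ∀ {k} (u u′ : Fin k) → δ u u′ ≡ δℕ (toℕ u) (toℕ u′)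
    δ-toℕ u u′ = ind-cong (u Fin.≟ u′) (toℕ u ℕ.≟ toℕ u′) (cong toℕ) toℕ-injective

    δ-left : ∀ a (u z : Fin p) → δ (u ↑ˡ q) ((τ ^ₚ a) (z ↑ˡ q)) ≡ δℕ (toℕ u) ((toℕ z ℕ.+ a) % p)
    δ-left a u z = begin
      δ (u ↑ˡ q) ((τ ^ₚ a) (z ↑ˡ q))                  ≡⟨ cong (δ (u ↑ˡ q)) (^ₚ-⊕ₚ-↑ˡ (rotation p′) (rotation q′) a z) ⟩
      δ (u ↑ˡ q) ((rotation p′ ^ₚ a) z ↑ˡ q)          ≡⟨ δ-injective (_↑ˡ q) (↑ˡ-injective q _ _) u _ ⟩
      δ u ((rotation p′ ^ₚ a) z)                      ≡⟨ δ-toℕ u _ ⟩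
      δℕ (toℕ u) (toℕ ((rotation p′ ^ₚ a) z))         ≡⟨ cong (δℕ (toℕ u)) (toℕ-rotation^ₚ p′ a z) ⟩
      δℕ (toℕ u) ((toℕ z ℕ.+ a) % p)                 ∎
      where open ≡-Reasoning

    δ-right : ∀ a (v w : Fin q) → δ (p ↑ʳ v) ((τ ^ₚ a) (p ↑ʳ w)) ≡ δℕ (toℕ v) ((toℕ w ℕ.+ a) % q)
    δ-right a v w = begin
      δ (p ↑ʳ v) ((τ ^ₚ a) (p ↑ʳ w))                  ≡⟨ cong (δ (p ↑ʳ v)) (^ₚ-⊕ₚ-↑ʳ (rotation p′) (rotation q′) a w) ⟩
      δ (p ↑ʳ v) (p ↑ʳ (rotation q′ ^ₚ a) w)          ≡⟨ δ-injective (p ↑ʳ_) (↑ʳ-injective p _ _) v _ ⟩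
      δ v ((rotation q′ ^ₚ a) w)                      ≡⟨ δ-toℕ v _ ⟩
      δℕ (toℕ v) (toℕ ((rotation q′ ^ₚ a) w))         ≡⟨ cong (δℕ (toℕ v)) (toℕ-rotation^ₚ q′ a w) ⟩
      δℕ (toℕ v) ((toℕ w ℕ.+ a) % q)                 ∎
      where open ≡-Reasoning

    δ-left-right : ∀ a (u : Fin p) (w : Fin q) → δ (u ↑ˡ q) ((τ ^ₚ a) (p ↑ʳ w)) ≡ 0ℤ
    δ-left-right a u w = δ-≢ λ u≡ → ↑ˡ≢↑ʳ u _ (trans u≡ (^ₚ-⊕ₚ-↑ʳ (rotation p′) (rotation q′) a w))

    δ-right-left : ∀ a (v : Fin q) (z : Fin p) → δ (p ↑ʳ v) ((τ ^ₚ a) (z ↑ˡ q)) ≡ 0ℤ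
    δ-right-left a v z = δ-≢ λ v≡ → ↑ˡ≢↑ʳ _ v (sym (trans v≡ (^ₚ-⊕ₚ-↑ˡ (rotation p′) (rotation q′) a z)))

  α-left : ∀ a (u : Fin p) → α a (u ↑ˡ q) ≡ δℕ (toℕ u) (a % p) - δℕ (toℕ u) ((h ℕ.+ a) % p)
  α-left a u = cong₂ _-_ (δ-left a u Fin.zero)
    (trans (δ-left a u (fromℕ< h<p)) (cong (λ z → δℕ (toℕ u) ((z ℕ.+ a) % p)) (toℕ-fromℕ< h<p)))

  α-right : ∀ a (v : Fin q) → α a (p ↑ʳ v) ≡ 0ℤ
  α-right a v = cong₂ _-_ (δ-right-left a v _) (δ-right-left a v _)

  γ-left : ∀ a (u : Fin p) → γ a (u ↑ˡ q) ≡ 0ℤ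
  γ-left a u = cong₂ _-_ (δ-left-right (suc a) u _) (δ-left-right (suc a) u _)

  γ-right : ∀ a (v : Fin q) → γ a (p ↑ʳ v) ≡ δℕ (toℕ v) ((q ℕ.+ a) % q) - δℕ (toℕ v) ((m₀ ℕ.+ a) % q)
  γ-right a v = cong₂ _-_ (trans (δ-right (suc a) v _) (cong (λ z → δℕ (toℕ v) (z % q)) J₁-shift))
                          (trans (δ-right (suc a) v _) (cong (λ z → δℕ (toℕ v) (z % q)) J₂-shift))
    where
    J₁-shift : toℕ (Fin.fromℕ q′) ℕ.+ suc a ≡ q ℕ.+ a
    J₁-shift = trans (cong (ℕ._+ suc a) (toℕ-fromℕ q′)) (ℕₚ.+-suc q′ a)
    J₂-shift : toℕ (fromℕ< (ℕ.s≤s (ℕₚ.m∸n≤m q′ l))) ℕ.+ suc a ≡ m₀ ℕ.+ a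
    J₂-shift = trans (cong (ℕ._+ suc a) (toℕ-fromℕ< _)) (ℕₚ.+-suc (q′ ℕ.∸ l) a)

  diagonal-cross-term≡0 : ∀ k a {r} → Split p q r → α a r * γ a ((τ ^ₚ k) r) ≡ 0ℤ
  diagonal-cross-term≡0 k a (left u) = trans (cong (α a (u ↑ˡ q) *_) γ≡0) (ℤₚ.*-zeroʳ (α a (u ↑ˡ q)))
    where
    γ≡0 : γ a ((τ ^ₚ k) (u ↑ˡ q)) ≡ 0ℤ
    γ≡0 = trans (cong (γ a) (^ₚ-⊕ₚ-↑ˡ (rotation p′) (rotation q′) k u)) (γ-left a ((rotation p′ ^ₚ k) u))
  diagonal-cross-term≡0 k a (right v) =
    trans (cong (_* γ a ((τ ^ₚ k) (p ↑ʳ v))) (α-right a v)) (ℤₚ.*-zeroˡ (γ a ((τ ^ₚ k) (p ↑ʳ v))))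

  powerFormula-diagonal : ∀ k r → powerFormula k r r ≡ δ r ((τ ^ₚ k) r)
  powerFormula-diagonal k r =
    trans (cong (δ r ((τ ^ₚ k) r) +_) (sumℕ-zero k (λ a → diagonal-cross-term≡0 k a (split p q r))))
          (ℤₚ.+-identityʳ (δ r ((τ ^ₚ k) r)))

  ^ₘ≋identity⇒τ^ₚ≡id : ∀ k → (target p q h l ^ₘ k) ≋ identity → ∀ r → (τ ^ₚ k) r ≡ r
  ^ₘ≋identity⇒τ^ₚ≡id k Aᵏ≋I r = sym (δ≡1⇒≡ (begin
    δ r ((τ ^ₚ k) r)              ≡⟨ sym (powerFormula-diagonal k r) ⟩
    powerFormula k r r            ≡⟨ sym (target^ₘ k r r) ⟩
    (target p q h l ^ₘ k) r r     ≡⟨ Aᵏ≋I r r ⟩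
    δ r r                         ≡⟨ δ-refl r ⟩
    1ℤ                            ∎))
    where open ≡-Reasoning

  ^ₘ≋identity⇒p∣ : ∀ k → (target p q h l ^ₘ k) ≋ identity → p ∣ k
  ^ₘ≋identity⇒p∣ k Aᵏ≋I = m%n≡0⇒n∣m k p (begin
    k % p                                        ≡⟨ sym (toℕ-rotation^ₚ p′ k Fin.zero) ⟩
    toℕ ((rotation p′ ^ₚ k) Fin.zero)             ≡⟨ cong toℕ (↑ˡ-injective q _ _ fixed) ⟩
    0                                            ∎)
    where
    open ≡-Reasoning
    fixed : (rotation p′ ^ₚ k) Fin.zero ↑ˡ q ≡ Fin.zero ↑ˡ q
    fixed = trans (sym (^ₚ-⊕ₚ-↑ˡ (rotation p′) (rotation q′) k Fin.zero)) (^ₘ≋identity⇒τ^ₚ≡id k Aᵏ≋I I₁)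

  ^ₘ≋identity⇒q∣ : ∀ k → (target p q h l ^ₘ k) ≋ identity → q ∣ k
  ^ₘ≋identity⇒q∣ k Aᵏ≋I = m%n≡0⇒n∣m k q (begin
    k % q                                        ≡⟨ sym (toℕ-rotation^ₚ q′ k Fin.zero) ⟩
    toℕ ((rotation q′ ^ₚ k) Fin.zero)             ≡⟨ cong toℕ (↑ʳ-injective p _ _ fixed) ⟩
    0                                            ∎)
    where
    open ≡-Reasoning
    fixed : p ↑ʳ (rotation q′ ^ₚ k) Fin.zero ≡ p ↑ʳ Fin.zero
    fixed = trans (sym (^ₚ-⊕ₚ-↑ʳ (rotation p′) (rotation q′) k Fin.zero)) (^ₘ≋identity⇒τ^ₚ≡id k Aᵏ≋I (p ↑ʳ Fin.zero))

  g : ℕ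
  g = gcd p q

  -- The entry (I₁, c₀) of an identity power is the sum of these terms.
  c₀ : Fin (p ℕ.+ q)
  c₀ = p ↑ʳ Fin.zero

  corner : ℕ → ℤ
  corner a = α a I₁ * γ a c₀

  corner-0 : corner 0 ≡ 1ℤ
  corner-0 = begin
    corner 0                                                      ≡⟨ cong₂ _*_ (α-left 0 Fin.zero) (γ-right 0 Fin.zero) ⟩
    (δℕ 0 0 - δℕ 0 ((h ℕ.+ 0) % p)) * (δℕ 0 ((q ℕ.+ 0) % q) - δℕ 0 ((m₀ ℕ.+ 0) % q))
      ≡⟨ cong₂ _*_ (cong (1ℤ -_) (ind-no (0 ℕ.≟ _) (0≢ h 1≤h h<p)))
                   (cong₂ _-_ (ind-yes (0 ℕ.≟ _) (sym (trans (cong (_% q) (ℕₚ.+-identityʳ q)) (n%n≡0 q))))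
                              (ind-no (0 ℕ.≟ _) (0≢ m₀ (ℕ.s≤s ℕ.z≤n) m₀<q))) ⟩
    (1ℤ - 0ℤ) * (1ℤ - 0ℤ)                                        ≡⟨⟩
    1ℤ                                                            ∎
    where
    open ≡-Reasoning
    0≢ : ∀ x {N} .{{_ : ℕ.NonZero N}} → 1 ℕ.≤ x → x ℕ.< N → ¬ 0 ≡ (x ℕ.+ 0) % N
    0≢ x 1≤x x<N 0≡x = ℕₚ.<⇒≢ 1≤x (trans 0≡x (trans (cong (ℕ._% _) (ℕₚ.+-identityʳ x)) (m<n⇒m%n≡m x<N)))
    m₀<q : m₀ ℕ.< q
    m₀<q = ℕ.s≤s (ℕₚ.∸-monoʳ-< {q′} {l} {0} 1≤l (ℕ.s≤s⁻¹ l<q))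

  corner-nonneg : ¬ g ∣ h → ¬ g ∣ l → ∀ a → 0ℤ ≤ corner a
  corner-nonneg g∤h g∤l a = subst (0ℤ ≤_) (sym (cong₂ _*_ (α-left a Fin.zero) (γ-right a Fin.zero)))
    (ind-sign (0 ℕ.≟ a % p) (0 ℕ.≟ (h ℕ.+ a) % p) (0 ℕ.≟ (q ℕ.+ a) % q) (0 ℕ.≟ (m₀ ℕ.+ a) % q)
              g∣m₀-case g∣h-case)
    where
    g∣ : ∀ {N x} .{{_ : ℕ.NonZero N}} → g ∣ N → 0 ≡ x % N → g ∣ x
    g∣ {N} {x} g∣N 0≡x%N = ∣-trans g∣N (m%n≡0⇒n∣m x N (sym 0≡x%N))
    g∣m₀-case : 0 ≡ a % p → 0 ≡ (m₀ ℕ.+ a) % q → ⊥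
    g∣m₀-case a≡0 m₀+a≡0 = g∤l (∣m+n∣m⇒∣n (subst (g ∣_) (sym m₀+l≡q) (gcd[m,n]∣n p q)) g∣m₀)
      where
      g∣m₀ : g ∣ m₀
      g∣m₀ = ∣m+n∣m⇒∣n (subst (g ∣_) (ℕₚ.+-comm m₀ a) (g∣ (gcd[m,n]∣n p q) m₀+a≡0)) (g∣ (gcd[m,n]∣m p q) a≡0)
    g∣h-case : 0 ≡ (h ℕ.+ a) % p → 0 ≡ (q ℕ.+ a) % q → ⊥
    g∣h-case h+a≡0 q+a≡0 = g∤h (∣m+n∣m⇒∣n (subst (g ∣_) (ℕₚ.+-comm h a) (g∣ (gcd[m,n]∣m p q) h+a≡0)) g∣a)
      where
      g∣a : g ∣ a
      g∣a = ∣m+n∣m⇒∣n (g∣ (gcd[m,n]∣n p q) q+a≡0) (gcd[m,n]∣n p q)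

  ^ₘ≋identity⇒corner-sum≡0 : ∀ k → (target p q h l ^ₘ k) ≋ identity → sumℕ k corner ≡ 0ℤ
  ^ₘ≋identity⇒corner-sum≡0 k Aᵏ≋I = begin
    sumℕ k corner                                              ≡⟨ sym (ℤₚ.+-identityˡ _) ⟩
    0ℤ + sumℕ k corner                                         ≡⟨ cong (_+ sumℕ k corner) (sym I₁c₀≡0) ⟩
    δ I₁ c₀ + sumℕ k (λ a → α a I₁ * γ a c₀)                  ≡⟨ cong (λ z → δ I₁ z + sumℕ k (λ a → α a I₁ * γ a z)) (sym c₀-fixed) ⟩
    powerFormula k I₁ c₀                                       ≡⟨ sym (target^ₘ k I₁ c₀) ⟩
    (target p q h l ^ₘ k) I₁ c₀                                ≡⟨ Aᵏ≋I I₁ c₀ ⟩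
    δ I₁ c₀                                                    ≡⟨ I₁c₀≡0 ⟩
    0ℤ                                                         ∎
    where
    open ≡-Reasoning
    I₁c₀≡0 : δ I₁ c₀ ≡ 0ℤ
    I₁c₀≡0 = δ-≢ {i = I₁} {j = c₀} (↑ˡ≢↑ʳ Fin.zero Fin.zero)
    c₀-fixed : (τ ^ₚ k) c₀ ≡ c₀
    c₀-fixed = ^ₘ≋identity⇒τ^ₚ≡id k Aᵏ≋I c₀

  hasFiniteOrder⇒gcd∣ : HasFiniteOrder (target p q h l) → g ∣ h ⊎ g ∣ l
  hasFiniteOrder⇒gcd∣ (k , 1≤k , Aᵏ≋I) = decidable-stable ((g ∣? h) ⊎-dec (g ∣? l)) λ g∤h∧g∤l →
    1≰0 (subst (1ℤ ≤_) (^ₘ≋identity⇒corner-sum≡0 k Aᵏ≋I)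
                       (corner-sum-positive k 1≤k (g∤h∧g∤l ∘ inj₁) (g∤h∧g∤l ∘ inj₂)))
    where
    1≰0 : ¬ 1ℤ ≤ 0ℤ
    1≰0 (+≤+ ())
    corner-sum-positive : ∀ k → 1 ℕ.≤ k → ¬ g ∣ h → ¬ g ∣ l → 1ℤ ≤ sumℕ k corner
    corner-sum-positive (suc k′) _ g∤h g∤l =
      ℤₚ.+-mono-≤ (ℤₚ.≤-reflexive (sym corner-0)) (sumℕ-nonneg k′ _ (λ a → corner-nonneg g∤h g∤l (suc a)))

  L : ℕ
  L = lcm p q

  τ^L≡id : ∀ {r} → Split p q r → (τ ^ₚ L) r ≡ r
  τ^L≡id (left u) =
    trans (^ₚ-⊕ₚ-↑ˡ (rotation p′) (rotation q′) L u) (cong (_↑ˡ q) (rotation^ₚ-multiple p′ (m∣lcm[m,n] p q) u))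
  τ^L≡id (right v) =
    trans (^ₚ-⊕ₚ-↑ʳ (rotation p′) (rotation q′) L v) (cong (p ↑ʳ_) (rotation^ₚ-multiple q′ (n∣lcm[m,n] p q) v))

  -- In the (u, v) block the cross terms are (X 0 - X h)(Y q - Y m₀); a common shift of the summation
  -- index by a suitable multiple of q (if g ∣ h) or of p (if g ∣ l) identifies the four sums in pairs.
  module CrossSum (u : Fin p) (v : Fin q) where

    X Y : ℕ → ℕ → ℤ
    X x a = δℕ (toℕ u) ((x ℕ.+ a) % p)
    Y y a = δℕ (toℕ v) ((y ℕ.+ a) % q)

    S : ℕ → ℕ → ℤ
    S x y = sumℕ L (λ a → X x a * Y y a)

    X-shift : ∀ {x x′ t} w → x ℕ.+ t ≡ x′ ℕ.+ w ℕ.* p → ∀ a → X x (a ℕ.+ t) ≡ X x′ a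
    X-shift {x} {x′} {t} w x+t≡ a = cong (δℕ (toℕ u)) (%-shift p {x} {x′} {t} w x+t≡ a)

    Y-shift : ∀ {y y′ t} w → y ℕ.+ t ≡ y′ ℕ.+ w ℕ.* q → ∀ a → Y y (a ℕ.+ t) ≡ Y y′ a
    Y-shift {y} {y′} {t} w y+t≡ a = cong (δℕ (toℕ v)) (%-shift q {y} {y′} {t} w y+t≡ a)

    S-shift : ∀ x y {x′ y′} t wp wq → x ℕ.+ t ≡ x′ ℕ.+ wp ℕ.* p → y ℕ.+ t ≡ y′ ℕ.+ wq ℕ.* q → S x y ≡ S x′ y′
    S-shift x y {x′} {y′} t wp wq x+t≡ y+t≡ = trans
      (sym (sumℕ-periodic L (λ a → X x a * Y y a) periodic t))
      (sumℕ-cong L (λ a → cong₂ _*_ (X-shift {x} {x′} {t} wp x+t≡ a) (Y-shift {y} {y′} {t} wq y+t≡ a)))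
      where
      periodic : ∀ a → X x (a ℕ.+ L) * Y y (a ℕ.+ L) ≡ X x a * Y y a
      periodic a = cong₂ _*_
        (X-shift {x} {x} {L} (_∣_.quotient (m∣lcm[m,n] p q)) (cong (x ℕ.+_) (_∣_.equality (m∣lcm[m,n] p q))) a)
        (Y-shift {y} {y} {L} (_∣_.quotient (n∣lcm[m,n] p q)) (cong (y ℕ.+_) (_∣_.equality (n∣lcm[m,n] p q))) a)

    S-shift-left : g ∣ h → ∀ y → S 0 y ≡ S h y
    S-shift-left g∣h y = shift (gcd∣⇒∃x+p*w≡q*w′ p q h (ℕ.s≤s ℕ.z≤n) g∣h)
      where
      shift : (∃₂ λ w w′ → h ℕ.+ p ℕ.* w ≡ q ℕ.* w′) → S 0 y ≡ S h y
      shift (w , w′ , h+pw≡qw′) =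
        S-shift 0 y {h} {y} (q ℕ.* w′) w w′ (trans (sym h+pw≡qw′) (cong (h ℕ.+_) (ℕₚ.*-comm p w)))
                                             (cong (y ℕ.+_) (ℕₚ.*-comm q w′))

    S-shift-right : g ∣ l → ∀ x → S x q ≡ S x m₀
    S-shift-right g∣l x = shift (gcd∣⇒∃x+p*w≡q*w′ q p m₀ (ℕ.s≤s ℕ.z≤n) (subst (_∣ m₀) (gcd-comm p q) g∣m₀))
      where
      g∣m₀ : g ∣ m₀
      g∣m₀ = ∣m+n∣m⇒∣n (subst (g ∣_) (trans (sym m₀+l≡q) (ℕₚ.+-comm m₀ l)) (gcd[m,n]∣n p q)) g∣l
      regroup : ∀ q m w → q ℕ.+ (m ℕ.+ q ℕ.* w) ≡ m ℕ.+ (q ℕ.+ w ℕ.* q)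
      regroup = solveℕ
      shift : (∃₂ λ w w′ → m₀ ℕ.+ q ℕ.* w ≡ p ℕ.* w′) → S x q ≡ S x m₀
      shift (w , w′ , m₀+qw≡pw′) =
        S-shift x q {x} {m₀} (p ℕ.* w′) w′ (suc w) (cong (x ℕ.+_) (ℕₚ.*-comm p w′))
                                                 (trans (cong (q ℕ.+_) (sym m₀+qw≡pw′)) (regroup q m₀ w))

    cross-sum≡0 : g ∣ h ⊎ g ∣ l → sumℕ L (λ a → α a (u ↑ˡ q) * γ a (p ↑ʳ v)) ≡ 0ℤ
    cross-sum≡0 g∣h⊎g∣l = begin
      sumℕ L (λ a → α a (u ↑ˡ q) * γ a (p ↑ʳ v))         ≡⟨ sumℕ-cong L (λ a → cong₂ _*_ (α-left a u) (γ-right a v)) ⟩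
      sumℕ L (λ a → (X 0 a - X h a) * (Y q a - Y m₀ a))  ≡⟨ sumℕ-bilinear L (X 0) (X h) (Y q) (Y m₀) ⟩
      (S 0 q - S h q) - (S 0 m₀ - S h m₀)                ≡⟨ cancel g∣h⊎g∣l ⟩
      0ℤ                                                 ∎
      where
      open ≡-Reasoning
      cancel : g ∣ h ⊎ g ∣ l → (S 0 q - S h q) - (S 0 m₀ - S h m₀) ≡ 0ℤ
      cancel (inj₁ g∣h) = cong₂ _-_ (ℤₚ.i≡j⇒i-j≡0 (S-shift-left g∣h q)) (ℤₚ.i≡j⇒i-j≡0 (S-shift-left g∣h m₀))
      cancel (inj₂ g∣l) = ℤₚ.i≡j⇒i-j≡0 (cong₂ _-_ (S-shift-right g∣l 0) (S-shift-right g∣l h))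

  cross-terms-vanish : g ∣ h ⊎ g ∣ l → ∀ {r c} → Split p q r → Split p q c → sumℕ L (λ a → α a r * γ a c) ≡ 0ℤ
  cross-terms-vanish _ {c = c} (right v) _ =
    sumℕ-zero L (λ a → trans (cong (_* γ a c) (α-right a v)) (ℤₚ.*-zeroˡ (γ a c)))
  cross-terms-vanish _ (left u) (left u′) =
    sumℕ-zero L (λ a → trans (cong (α a (u ↑ˡ q) *_) (γ-left a u′)) (ℤₚ.*-zeroʳ (α a (u ↑ˡ q))))
  cross-terms-vanish g∣h⊎g∣l (left u) (right v) = CrossSum.cross-sum≡0 u v g∣h⊎g∣l

  gcd∣⇒target^L≋identity : g ∣ h ⊎ g ∣ l → (target p q h l ^ₘ L) ≋ identity
  gcd∣⇒target^L≋identity g∣h⊎g∣l r c = begin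
    (target p q h l ^ₘ L) r c                          ≡⟨ target^ₘ L r c ⟩
    δ r ((τ ^ₚ L) c) + sumℕ L (λ a → α a r * γ a ((τ ^ₚ L) c))
                                                       ≡⟨ cong (λ z → δ r z + sumℕ L (λ a → α a r * γ a z)) (τ^L≡id (split p q c)) ⟩
    δ r c + sumℕ L (λ a → α a r * γ a c)               ≡⟨ cong (δ r c +_) (cross-terms-vanish g∣h⊎g∣l (split p q r) (split p q c)) ⟩
    δ r c + 0ℤ                                         ≡⟨ ℤₚ.+-identityʳ (δ r c) ⟩
    δ r c                                              ∎
    where open ≡-Reasoning

  gcd∣⇒multOrder : g ∣ h ⊎ g ∣ l → MultOrder (target p q h l) L
  gcd∣⇒multOrder g∣h⊎g∣l = 1≤L , gcd∣⇒target^L≋identity g∣h⊎g∣l , least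
    where
    1≤L : 1 ℕ.≤ L
    1≤L = ℕₚ.n≢0⇒n>0 λ L≡0 → ℕₚ.0≢1+n (sym (trans (sym (gcd*lcm p q)) (trans (cong (g ℕ.*_) L≡0) (ℕₚ.*-zeroʳ g))))
    least : ∀ m → 1 ℕ.≤ m → (target p q h l ^ₘ m) ≋ identity → L ℕ.≤ m
    least (suc m) _ Aᵐ≋I = ∣⇒≤ (lcm-least (^ₘ≋identity⇒p∣ (suc m) Aᵐ≋I) (^ₘ≋identity⇒q∣ (suc m) Aᵐ≋I))

module Cycles {n} (σ : Permutation′ n) where

  open Permutations
  open import Data.Nat using (_+_; _∸_; _≤_; _<_)
  open import Data.Nat.DivMod using (_%_; m%n<n)
  open import Data.Fin.Properties using (pigeonhole; toℕ-fromℕ<; toℕ-inject; ¬∀⟶∃¬-smallest)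
  open import Relation.Binary.Definitions using (tri<; tri≈; tri>)
  open import Relation.Nullary.Decidable using (¬?; decidable-stable)

  IsMinimalPeriod : Fin n → ℕ → Set
  IsMinimalPeriod x N = (σ ^ₚ N) x ≡ x × (∀ a → 1 ≤ a → a < N → ¬ (σ ^ₚ a) x ≡ x)

  σ^[j∸i] : ∀ {i j} x → i ≤ j → (σ ^ₚ i) x ≡ (σ ^ₚ j) x → (σ ^ₚ (j ∸ i)) x ≡ x
  σ^[j∸i] {i} {j} x i≤j σⁱx≡σʲx = sym (^ₚ-injective σ i (begin
    (σ ^ₚ i) x                  ≡⟨ σⁱx≡σʲx ⟩
    (σ ^ₚ j) x                  ≡⟨ cong (λ k → (σ ^ₚ k) x) (sym (ℕₚ.m+[n∸m]≡n i≤j)) ⟩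
    (σ ^ₚ (i + (j ∸ i))) x      ≡⟨ ^ₚ-+ σ i (j ∸ i) x ⟩
    (σ ^ₚ i) ((σ ^ₚ (j ∸ i)) x) ∎))
    where open ≡-Reasoning

  somePeriod : ∀ x → ∃ λ N′ → N′ < n × (σ ^ₚ suc N′) x ≡ x
  somePeriod x = from-collision (pigeonhole (ℕₚ.n<1+n n) (λ i → (σ ^ₚ toℕ i) x))
    where
    from-collision : (∃₂ λ (i j : Fin (suc n)) → toℕ i < toℕ j × (σ ^ₚ toℕ i) x ≡ (σ ^ₚ toℕ j) x) →
                     ∃ λ N′ → N′ < n × (σ ^ₚ suc N′) x ≡ x
    from-collision (i , j , i<j , σⁱx≡σʲx) =
      toℕ j ∸ suc (toℕ i) ,
      subst (_≤ n) (sym 1+N′≡j∸i) (ℕₚ.≤-trans (ℕₚ.m∸n≤m (toℕ j) (toℕ i)) (ℕ.s≤s⁻¹ (Finₚ.toℕ<n j))) ,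
      subst (λ N → (σ ^ₚ N) x ≡ x) (sym 1+N′≡j∸i) (σ^[j∸i] x (ℕₚ.<⇒≤ i<j) σⁱx≡σʲx)
      where
      1+N′≡j∸i : suc (toℕ j ∸ suc (toℕ i)) ≡ toℕ j ∸ toℕ i
      1+N′≡j∸i = sym (ℕₚ.+-∸-assoc 1 i<j)

  minimalPeriod : ∀ x → ∃ λ N′ → IsMinimalPeriod x (suc N′)
  minimalPeriod x = from-smallest (¬∀⟶∃¬-smallest n NotPeriod (λ k → ¬? ((σ ^ₚ suc (toℕ k)) x Fin.≟ x))
                                                  (λ all → refute all (somePeriod x)))
    where
    NotPeriod : Fin n → Set
    NotPeriod k = ¬ (σ ^ₚ suc (toℕ k)) x ≡ x
    refute : (∀ k → NotPeriod k) → (∃ λ N′ → N′ < n × (σ ^ₚ suc N′) x ≡ x) → ⊥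
    refute all (N′ , N′<n , σᴺx≡x) =
      all (fromℕ< N′<n) (subst (λ m → (σ ^ₚ suc m) x ≡ x) (sym (toℕ-fromℕ< N′<n)) σᴺx≡x)
    from-smallest : (∃ λ k → ¬ NotPeriod k × ((j : Fin (toℕ k)) → NotPeriod (Fin.inject j))) →
                    ∃ λ N′ → IsMinimalPeriod x (suc N′)
    from-smallest (k , ¬¬period , smaller-not) =
      toℕ k , decidable-stable ((σ ^ₚ suc (toℕ k)) x Fin.≟ x) ¬¬period , minimal
      where
      minimal : ∀ a → 1 ≤ a → a < suc (toℕ k) → ¬ (σ ^ₚ a) x ≡ x
      minimal (suc a) _ a<k = subst NotPeriod′ (trans (toℕ-inject j) (toℕ-fromℕ< (ℕ.s≤s⁻¹ a<k))) (smaller-not j)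
        where
        NotPeriod′ : ℕ → Set
        NotPeriod′ m = ¬ (σ ^ₚ suc m) x ≡ x
        j : Fin (toℕ k)
        j = fromℕ< (ℕ.s≤s⁻¹ a<k)

  SameCycle-trans : ∀ {x y z} → SameCycle σ x y → SameCycle σ y z → SameCycle σ x z
  SameCycle-trans {x} (a , σᵃx≡y) (b , σᵇy≡z) = b + a , trans (^ₚ-+ σ b a x) (trans (cong (σ ^ₚ b) σᵃx≡y) σᵇy≡z)

  SameCycle-sym : ∀ {x y} → SameCycle σ x y → SameCycle σ y x
  SameCycle-sym {x} {y} (k , σᵏx≡y) = go (somePeriod x)
    where
    go : (∃ λ N′ → N′ < n × (σ ^ₚ suc N′) x ≡ x) → SameCycle σ y x
    go (N′ , _ , σᴺx≡x) = N ∸ k % N , (begin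
      (σ ^ₚ (N ∸ k % N)) y                     ≡⟨ cong (σ ^ₚ (N ∸ k % N)) (trans (sym σᵏx≡y) (^ₚ-% σ N σᴺx≡x k)) ⟩
      (σ ^ₚ (N ∸ k % N)) ((σ ^ₚ (k % N)) x)    ≡⟨ sym (^ₚ-+ σ (N ∸ k % N) (k % N) x) ⟩
      (σ ^ₚ (N ∸ k % N + k % N)) x             ≡⟨ cong (λ m → (σ ^ₚ m) x) (ℕₚ.m∸n+n≡m (ℕₚ.<⇒≤ (m%n<n k N))) ⟩
      (σ ^ₚ N) x                               ≡⟨ σᴺx≡x ⟩
      x                                        ∎)
      where
      open ≡-Reasoning
      N : ℕ
      N = suc N′

  ^ₚ-fixes-cycle : ∀ N {x y} → (σ ^ₚ N) x ≡ x → SameCycle σ y x → (σ ^ₚ N) y ≡ y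
  ^ₚ-fixes-cycle N {x} {y} σᴺx≡x (k , σᵏy≡x) = ^ₚ-injective σ k (begin
    (σ ^ₚ k) ((σ ^ₚ N) y)     ≡⟨ sym (^ₚ-+ σ k N y) ⟩
    (σ ^ₚ (k + N)) y          ≡⟨ cong (λ m → (σ ^ₚ m) y) (ℕₚ.+-comm k N) ⟩
    (σ ^ₚ (N + k)) y          ≡⟨ ^ₚ-+ σ N k y ⟩
    (σ ^ₚ N) ((σ ^ₚ k) y)     ≡⟨ cong (σ ^ₚ N) σᵏy≡x ⟩
    (σ ^ₚ N) x                ≡⟨ σᴺx≡x ⟩
    x                         ≡⟨ sym σᵏy≡x ⟩
    (σ ^ₚ k) y                ∎)
    where open ≡-Reasoning

  twoCycles⇒cover : TwoCycles σ → ∀ {x y} → ¬ SameCycle σ x y → ∀ z → SameCycle σ x z ⊎ SameCycle σ y z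
  twoCycles⇒cover (_ , _ , _ , covers) {x} {y} x≁y z with covers x | covers y | covers z
  ... | inj₁ a~x | inj₁ a~y | _ = ⊥-elim (x≁y (SameCycle-trans (SameCycle-sym a~x) a~y))
  ... | inj₂ b~x | inj₂ b~y | _ = ⊥-elim (x≁y (SameCycle-trans (SameCycle-sym b~x) b~y))
  ... | inj₁ a~x | inj₂ _ | inj₁ a~z = inj₁ (SameCycle-trans (SameCycle-sym a~x) a~z)
  ... | inj₁ _ | inj₂ b~y | inj₂ b~z = inj₂ (SameCycle-trans (SameCycle-sym b~y) b~z)
  ... | inj₂ b~x | inj₁ _ | inj₂ b~z = inj₁ (SameCycle-trans (SameCycle-sym b~x) b~z)
  ... | inj₂ _ | inj₁ a~y | inj₁ a~z = inj₂ (SameCycle-trans (SameCycle-sym a~y) a~z)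

  orbit-injective : ∀ {x N} → IsMinimalPeriod x N → ∀ {a b} → a < N → b < N → (σ ^ₚ a) x ≡ (σ ^ₚ b) x → a ≡ b
  orbit-injective {x} {N} (_ , minimal) {a} {b} a<N b<N σᵃx≡σᵇx with ℕₚ.<-cmp a b
  ... | tri≈ _ a≡b _ = a≡b
  ... | tri< a<b _ _ = ⊥-elim (minimal (b ∸ a) (ℕₚ.m<n⇒0<n∸m a<b) (ℕₚ.≤-<-trans (ℕₚ.m∸n≤m b a) b<N)
                                       (σ^[j∸i] x (ℕₚ.<⇒≤ a<b) σᵃx≡σᵇx))
  ... | tri> _ _ b<a = ⊥-elim (minimal (a ∸ b) (ℕₚ.m<n⇒0<n∸m b<a) (ℕₚ.≤-<-trans (ℕₚ.m∸n≤m a b) a<N)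
                                       (σ^[j∸i] x (ℕₚ.<⇒≤ b<a) (sym σᵃx≡σᵇx)))

module Normalisation {n} (σ : Permutation′ n) (i₁ j₁ i₂ j₂ : Fin n)
    (i₁≢i₂ : ¬ i₁ ≡ i₂) (j₁≢j₂ : ¬ j₁ ≡ j₂) (twoCycles : TwoCycles σ)
    (i₁~i₂ : SameCycle σ i₁ i₂) (j₂~j₁ : SameCycle σ j₂ j₁) (i₁≁j₂ : ¬ SameCycle σ i₁ j₂)
    (p′ q′ : ℕ) (i₁-period : Cycles.IsMinimalPeriod σ i₁ (suc p′))
    (j₁-period : Cycles.IsMinimalPeriod σ j₁ (suc q′)) where

  open Kronecker
  open Matrices using (Relabelling)
  open RankOnePerturbation using (rankOne; relabelling-permMat⊕rankOne)
  open Permutations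
  open PermutationMatrices using (Tblock-rankOne)
  open Cycles σ
  open import Data.Integer using () renaming (_+_ to _+ℤ_)
  open import Data.Nat using (_+_; _≤_; _<_)
  open import Data.Nat.DivMod using (_%_; m%n<n)
  open import Data.Fin.Properties using (toℕ-injective; toℕ-fromℕ<; toℕ-fromℕ; toℕ<n; splitAt-↑ˡ; splitAt-↑ʳ)

  p q : ℕ
  p = suc p′
  q = suc q′

  h l : ℕ
  h = proj₁ i₁~i₂ % p
  l = proj₁ j₂~j₁ % q

  σʰi₁≡i₂ : (σ ^ₚ h) i₁ ≡ i₂
  σʰi₁≡i₂ = trans (sym (^ₚ-% σ p (proj₁ i₁-period) (proj₁ i₁~i₂))) (proj₂ i₁~i₂)

  σ^q-j₂ : (σ ^ₚ q) j₂ ≡ j₂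
  σ^q-j₂ = ^ₚ-fixes-cycle q (proj₁ j₁-period) j₂~j₁

  σˡj₂≡j₁ : (σ ^ₚ l) j₂ ≡ j₁
  σˡj₂≡j₁ = trans (sym (^ₚ-% σ q σ^q-j₂ (proj₁ j₂~j₁))) (proj₂ j₂~j₁)

  1≤h : 1 ≤ h
  1≤h = ℕₚ.n≢0⇒n>0 λ h≡0 → i₁≢i₂ (trans (cong (λ k → (σ ^ₚ k) i₁) (sym h≡0)) σʰi₁≡i₂)

  h<p : h < p
  h<p = m%n<n (proj₁ i₁~i₂) p

  1≤l : 1 ≤ l
  1≤l = ℕₚ.n≢0⇒n>0 λ l≡0 → j₁≢j₂ (sym (trans (cong (λ k → (σ ^ₚ k) j₂) (sym l≡0)) σˡj₂≡j₁))

  l<q : l < q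
  l<q = m%n<n (proj₁ j₂~j₁) q

  open Target p′ q′ h l 1≤h h<p 1≤l l<q using (τ; I₁; I₂; J₁; J₂; m₀; m₀+l≡q; target≋)

  i₁≁j₁ : ¬ SameCycle σ i₁ j₁
  i₁≁j₁ i₁~j₁ = i₁≁j₂ (SameCycle-trans i₁~j₁ (SameCycle-sym j₂~j₁))

  cycle-of-i₁-or-j₁ : ∀ z → SameCycle σ i₁ z ⊎ SameCycle σ j₁ z
  cycle-of-i₁-or-j₁ = twoCycles⇒cover twoCycles i₁≁j₁

  -- The left block enumerates the cycle of i₁ from i₁, the right block the cycle of j₁ from σ j₁,
  -- so that the last right index J₁ lands on j₁.
  ρ⊎ : Fin p ⊎ Fin q → Fin n
  ρ⊎ (inj₁ u) = (σ ^ₚ toℕ u) i₁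
  ρ⊎ (inj₂ v) = (σ ^ₚ suc (toℕ v)) j₁

  ρ : Fin (p + q) → Fin n
  ρ r = ρ⊎ (splitAt p r)

  ρ-left : ∀ (u : Fin p) → ρ (u ↑ˡ q) ≡ (σ ^ₚ toℕ u) i₁
  ρ-left u = cong ρ⊎ (splitAt-↑ˡ p u q)

  ρ-right : ∀ (v : Fin q) → ρ (p ↑ʳ v) ≡ (σ ^ₚ suc (toℕ v)) j₁
  ρ-right v = cong ρ⊎ (splitAt-↑ʳ p q v)

  ρ-injective : ∀ {x y} → ρ x ≡ ρ y → x ≡ y
  ρ-injective {x} {y} = on-blocks (split p q x) (split p q y)
    where
    i₁≁σᵛj₁ : ∀ u v → ¬ (σ ^ₚ u) i₁ ≡ (σ ^ₚ v) j₁
    i₁≁σᵛj₁ u v σᵘi₁≡σᵛj₁ = i₁≁j₁ (SameCycle-trans (u , σᵘi₁≡σᵛj₁) (SameCycle-sym (v , refl)))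
    on-blocks : ∀ {x y} → Split p q x → Split p q y → ρ x ≡ ρ y → x ≡ y
    on-blocks (left u) (left u′) ρx≡ρy = cong (_↑ˡ q) (toℕ-injective
      (orbit-injective i₁-period (toℕ<n u) (toℕ<n u′) (trans (sym (ρ-left u)) (trans ρx≡ρy (ρ-left u′)))))
    on-blocks (right v) (right v′) ρx≡ρy = cong (p ↑ʳ_) (toℕ-injective
      (orbit-injective j₁-period (toℕ<n v) (toℕ<n v′) (⟨$⟩ʳ-injective σ (trans (sym (ρ-right v)) (trans ρx≡ρy (ρ-right v′))))))
    on-blocks (left u) (right v) ρx≡ρy =
      ⊥-elim (i₁≁σᵛj₁ (toℕ u) (suc (toℕ v)) (trans (sym (ρ-left u)) (trans ρx≡ρy (ρ-right v))))
    on-blocks (right v) (left u) ρx≡ρy =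
      ⊥-elim (i₁≁σᵛj₁ (toℕ u) (suc (toℕ v)) (trans (sym (ρ-left u)) (trans (sym ρx≡ρy) (ρ-right v))))

  preimage : ∀ z → SameCycle σ i₁ z ⊎ SameCycle σ j₁ z → Fin (p + q)
  preimage z (inj₁ (k , _)) = fromℕ< (m%n<n k p) ↑ˡ q
  preimage z (inj₂ (k , _)) = p ↑ʳ fromℕ< (m%n<n (k + q′) q)

  ρ-preimage : ∀ z c → ρ (preimage z c) ≡ z
  ρ-preimage z (inj₁ (k , σᵏi₁≡z)) = begin
    ρ (fromℕ< (m%n<n k p) ↑ˡ q)      ≡⟨ ρ-left (fromℕ< (m%n<n k p)) ⟩
    (σ ^ₚ toℕ (fromℕ< (m%n<n k p))) i₁ ≡⟨ cong (λ m → (σ ^ₚ m) i₁) (toℕ-fromℕ< (m%n<n k p)) ⟩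
    (σ ^ₚ (k % p)) i₁                 ≡⟨ sym (^ₚ-% σ p (proj₁ i₁-period) k) ⟩
    (σ ^ₚ k) i₁                       ≡⟨ σᵏi₁≡z ⟩
    z                                 ∎
    where open ≡-Reasoning
  ρ-preimage z (inj₂ (k , σᵏj₁≡z)) = begin
    ρ (p ↑ʳ fromℕ< (m%n<n (k + q′) q))     ≡⟨ ρ-right (fromℕ< (m%n<n (k + q′) q)) ⟩
    (σ ^ₚ suc (toℕ (fromℕ< (m%n<n (k + q′) q)))) j₁
                                            ≡⟨ cong (λ m → (σ ^ₚ suc m) j₁) (toℕ-fromℕ< (m%n<n (k + q′) q)) ⟩
    σ ⟨$⟩ʳ (σ ^ₚ ((k + q′) % q)) j₁         ≡⟨ cong (σ ⟨$⟩ʳ_) (sym (^ₚ-% σ q (proj₁ j₁-period) (k + q′))) ⟩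
    (σ ^ₚ suc (k + q′)) j₁                  ≡⟨ cong (λ m → (σ ^ₚ m) j₁) (sym (ℕₚ.+-suc k q′)) ⟩
    (σ ^ₚ (k + q)) j₁                       ≡⟨ ^ₚ-+ σ k q j₁ ⟩
    (σ ^ₚ k) ((σ ^ₚ q) j₁)                  ≡⟨ cong (σ ^ₚ k) (proj₁ j₁-period) ⟩
    (σ ^ₚ k) j₁                             ≡⟨ σᵏj₁≡z ⟩
    z                                       ∎
    where open ≡-Reasoning

  ρ⁻¹ : Fin n → Fin (p + q)
  ρ⁻¹ z = preimage z (cycle-of-i₁-or-j₁ z)

  ρₚ : Permutation (p + q) n
  ρₚ = permutation ρ ρ⁻¹ (λ z → ρ-preimage z (cycle-of-i₁-or-j₁ z))
                         (λ x → ρ-injective (ρ-preimage (ρ x) (cycle-of-i₁-or-j₁ (ρ x))))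

  ρ-τ : ∀ y → ρ (τ ⟨$⟩ʳ y) ≡ σ ⟨$⟩ʳ ρ y
  ρ-τ y = on-blocks (split p q y)
    where
    on-blocks : ∀ {y} → Split p q y → ρ (τ ⟨$⟩ʳ y) ≡ σ ⟨$⟩ʳ ρ y
    on-blocks (left u) = begin
      ρ (τ ⟨$⟩ʳ (u ↑ˡ q))                         ≡⟨ cong ρ (^ₚ-⊕ₚ-↑ˡ (rotation p′) (rotation q′) 1 u) ⟩
      ρ ((rotation p′ ⟨$⟩ʳ u) ↑ˡ q)              ≡⟨ ρ-left (rotation p′ ⟨$⟩ʳ u) ⟩
      (σ ^ₚ toℕ (rotation p′ ⟨$⟩ʳ u)) i₁         ≡⟨ cong (λ m → (σ ^ₚ m) i₁) (toℕ-rotation p′ u) ⟩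
      (σ ^ₚ (suc (toℕ u) % p)) i₁                ≡⟨ sym (^ₚ-% σ p (proj₁ i₁-period) (suc (toℕ u))) ⟩
      σ ⟨$⟩ʳ (σ ^ₚ toℕ u) i₁                      ≡⟨ cong (σ ⟨$⟩ʳ_) (sym (ρ-left u)) ⟩
      σ ⟨$⟩ʳ ρ (u ↑ˡ q)                           ∎
      where open ≡-Reasoning
    on-blocks (right v) = begin
      ρ (τ ⟨$⟩ʳ (p ↑ʳ v))                         ≡⟨ cong ρ (^ₚ-⊕ₚ-↑ʳ (rotation p′) (rotation q′) 1 v) ⟩
      ρ (p ↑ʳ (rotation q′ ⟨$⟩ʳ v))              ≡⟨ ρ-right (rotation q′ ⟨$⟩ʳ v) ⟩
      σ ⟨$⟩ʳ (σ ^ₚ toℕ (rotation q′ ⟨$⟩ʳ v)) j₁  ≡⟨ cong (λ m → σ ⟨$⟩ʳ (σ ^ₚ m) j₁) (toℕ-rotation q′ v) ⟩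
      σ ⟨$⟩ʳ (σ ^ₚ (suc (toℕ v) % q)) j₁         ≡⟨ cong (σ ⟨$⟩ʳ_) (sym (^ₚ-% σ q (proj₁ j₁-period) (suc (toℕ v)))) ⟩
      σ ⟨$⟩ʳ (σ ^ₚ suc (toℕ v)) j₁                ≡⟨ cong (σ ⟨$⟩ʳ_) (sym (ρ-right v)) ⟩
      σ ⟨$⟩ʳ ρ (p ↑ʳ v)                           ∎
      where open ≡-Reasoning

  ρ-I₁ : ρ I₁ ≡ i₁
  ρ-I₁ = ρ-left Fin.zero

  ρ-I₂ : ρ I₂ ≡ i₂
  ρ-I₂ = trans (ρ-left (fromℕ< h<p)) (trans (cong (λ m → (σ ^ₚ m) i₁) (toℕ-fromℕ< h<p)) σʰi₁≡i₂)

  ρ-J₁ : ρ J₁ ≡ j₁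
  ρ-J₁ = trans (ρ-right (Fin.fromℕ q′)) (trans (cong (λ m → (σ ^ₚ suc m) j₁) (toℕ-fromℕ q′)) (proj₁ j₁-period))

  ρ-J₂ : ρ J₂ ≡ j₂
  ρ-J₂ = begin
    ρ J₂                              ≡⟨ ρ-right (fromℕ< q′∸l<q) ⟩
    (σ ^ₚ suc (toℕ (fromℕ< q′∸l<q))) j₁
                                      ≡⟨ cong (λ m → (σ ^ₚ suc m) j₁) (toℕ-fromℕ< q′∸l<q) ⟩
    (σ ^ₚ m₀) j₁                      ≡⟨ cong (σ ^ₚ m₀) (sym σˡj₂≡j₁) ⟩
    (σ ^ₚ m₀) ((σ ^ₚ l) j₂)           ≡⟨ sym (^ₚ-+ σ m₀ l j₂) ⟩
    (σ ^ₚ (m₀ + l)) j₂                ≡⟨ cong (λ m → (σ ^ₚ m) j₂) m₀+l≡q ⟩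
    (σ ^ₚ q) j₂                       ≡⟨ σ^q-j₂ ⟩
    j₂                                ∎
    where
    open ≡-Reasoning
    q′∸l<q : q′ ℕ.∸ l < q
    q′∸l<q = ℕ.s≤s (ℕₚ.m∸n≤m q′ l)

  relabelling : Relabelling ρₚ (PTmatrix σ i₁ j₁ i₂ j₂) (target p q h l)
  relabelling x y = begin
    target p q h l x y                                          ≡⟨ target≋ x y ⟩
    (permMat τ ⊕ₘ rankOne I₁ I₂ J₁ J₂) x y                      ≡⟨ relabelling-permMat⊕rankOne ρₚ {τ} {σ} ρ-τ ρ-I₁ ρ-I₂ ρ-J₁ ρ-J₂ x y ⟩
    (permMat σ ⊕ₘ rankOne i₁ i₂ j₁ j₂) (ρ x) (ρ y)             ≡⟨ cong (permMat σ (ρ x) (ρ y) +ℤ_)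
                                                                      (sym (Tblock-rankOne i₁ j₁ i₂ j₂ refl refl refl refl (ρ x) (ρ y))) ⟩
    PTmatrix σ i₁ j₁ i₂ j₂ (ρ x) (ρ y)                          ∎
    where open ≡-Reasoning

open import Data.Nat using (_+_; _≤_; _<_)
open import Data.Nat.GCD using (gcd)
open import Data.Nat.LCM using (lcm)
open import Data.Nat.Divisibility using (_∣_)
open Matrices using (Relabelling; permSimilar⇒sameIdentityPowers; relabelling⇒sameIdentityPowers;
                     relabelling⇒permSimilar; transpose-sameIdentityPowers; multOrder-resp; hasFiniteOrder-resp)

record NormalForm {n} (A : Matrix n) : Set where
  field
    p′ q′ h l : ℕ
    1≤h : 1 ≤ h
    h<p : h < suc p′
    1≤l : 1 ≤ l
    l<q : l < suc q′
    ρ : Permutation (suc p′ + suc q′) n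
    relabelling : Relabelling ρ A (target (suc p′) (suc q′) h l)

type2c⇒normalForm : ∀ {n} (σ : Permutation′ n) {i₁ j₁ i₂ j₂} → Type2c σ i₁ j₁ i₂ j₂ → NormalForm (PTmatrix σ i₁ j₁ i₂ j₂)
type2c⇒normalForm σ {i₁} {j₁} {i₂} {j₂} (i₁≢i₂ , j₁≢j₂ , _ , _ , _ , _ , twoCycles , i₁~i₂ , j₂~j₁ , i₁≁j₂) =
  from-periods (Cycles.minimalPeriod σ i₁) (Cycles.minimalPeriod σ j₁)
  where
  from-periods : (∃ λ p′ → Cycles.IsMinimalPeriod σ i₁ (suc p′)) →
                 (∃ λ q′ → Cycles.IsMinimalPeriod σ j₁ (suc q′)) →
                 NormalForm (PTmatrix σ i₁ j₁ i₂ j₂)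
  from-periods (p′ , i₁-period) (q′ , j₁-period) = record
    { p′ = p′ ; q′ = q′ ; h = h ; l = l ; 1≤h = 1≤h ; h<p = h<p ; 1≤l = 1≤l ; l<q = l<q
    ; ρ = ρₚ ; relabelling = relabelling }
    where open Normalisation σ i₁ j₁ i₂ j₂ i₁≢i₂ j₁≢j₂ twoCycles i₁~i₂ j₂~j₁ i₁≁j₂ p′ q′ i₁-period j₁-period

-- The relabelling always reaches A itself: the transposed alternative only matters for the converse.
hasFiniteOrder⇒similarToTarget : ∀ {n} {A : Matrix n} → NormalForm A → HasFiniteOrder A →
  ∃ λ p → ∃ λ q → ∃ λ h → ∃ λ l → Σ (p + q ≡ n) λ e →
    1 ≤ h × h < p × 1 ≤ l × l < q × (gcd p q ∣ h ⊎ gcd p q ∣ l)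
    × (PermSimilar A (subst Matrix e (target p q h l)) ⊎ PermSimilar (transpose A) (subst Matrix e (target p q h l)))
hasFiniteOrder⇒similarToTarget nf finite =
  suc p′ , suc q′ , h , l , ↔⇒≡ ρ , 1≤h , h<p , 1≤l , l<q ,
  Target.hasFiniteOrder⇒gcd∣ p′ q′ h l 1≤h h<p 1≤l l<q
    (hasFiniteOrder-resp (relabelling⇒sameIdentityPowers {π = ρ} relabelling) finite) ,
  inj₁ (relabelling⇒permSimilar (↔⇒≡ ρ) ρ relabelling)
  where open NormalForm nf

similarToTarget⇒multOrder : ∀ {n} (A : Matrix n) p q h l (e : p + q ≡ n) →
  1 ≤ h → h < p → 1 ≤ l → l < q → (gcd p q ∣ h ⊎ gcd p q ∣ l) →
  (PermSimilar A (subst Matrix e (target p q h l)) ⊎ PermSimilar (transpose A) (subst Matrix e (target p q h l))) →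
  MultOrder A (lcm p q)
similarToTarget⇒multOrder A (suc p′) (suc q′) h l refl 1≤h h<p 1≤l l<q gcd∣ (inj₁ A∼T) =
  multOrder-resp (permSimilar⇒sameIdentityPowers A∼T) (Target.gcd∣⇒multOrder p′ q′ h l 1≤h h<p 1≤l l<q gcd∣)
similarToTarget⇒multOrder A (suc p′) (suc q′) h l refl 1≤h h<p 1≤l l<q gcd∣ (inj₂ Aᵀ∼T) =
  multOrder-resp (transpose-sameIdentityPowers A)
    (multOrder-resp (permSimilar⇒sameIdentityPowers Aᵀ∼T) (Target.gcd∣⇒multOrder p′ q′ h l 1≤h h<p 1≤l l<q gcd∣))

theorem4p7 : ∀ (n : ℕ) (σ : Permutation′ n) (i1 j1 i2 j2 : Fin n) →
    Type2c σ i1 j1 i2 j2 →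
    (HasFiniteOrder (PTmatrix σ i1 j1 i2 j2) →
      ∃ λ p → ∃ λ q → ∃ λ h → ∃ λ l → Σ (p + q ≡ n) λ e →
        1 ≤ h × h < p × 1 ≤ l × l < q × (gcd p q ∣ h ⊎ gcd p q ∣ l)
        × (PermSimilar (PTmatrix σ i1 j1 i2 j2) (subst Matrix e (target p q h l))
           ⊎ PermSimilar (transpose (PTmatrix σ i1 j1 i2 j2)) (subst Matrix e (target p q h l))))
    × (∀ p q h l (e : p + q ≡ n) →
        1 ≤ h → h < p → 1 ≤ l → l < q → (gcd p q ∣ h ⊎ gcd p q ∣ l) →
        (PermSimilar (PTmatrix σ i1 j1 i2 j2) (subst Matrix e (target p q h l))
           ⊎ PermSimilar (transpose (PTmatrix σ i1 j1 i2 j2)) (subst Matrix e (target p q h l))) →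
        MultOrder (PTmatrix σ i1 j1 i2 j2) (lcm p q))
theorem4p7 n σ i1 j1 i2 j2 type2c =
  hasFiniteOrder⇒similarToTarget (type2c⇒normalForm σ type2c) , similarToTarget⇒multOrder (PTmatrix σ i1 j1 i2 j2)
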